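{- Let $k\ge1$, let $D$ be a $k$-extremal digraph and let $[u,v]\subseteq A(D)$. Then for every $k$-dicolouring of $D-[u,v]$ there is neither a monochromatic directed $uv$-path nor a monochromatic directed $vu$-path. Consequently, there exists an assignment of $k$ colours to the vertices of $D$ such that the only monochromatic directed cycle is the digon $[u,v]$.
   Context: Digraphs are finite, without loops or parallel arcs, but may contain digons; $[u,v]$ denotes the pair of arcs $\{uv,vu\}$ and $D-[u,v]$ the digraph with both arcs removed. A $k$-dicolouring is a map $V(D)\to\{1,\dots,k\}$ whose colour classes induce acyclic subdigraphs; $\vec{\chi}(D)$ is the least such $k$. $\lambda_D(x,y)$ is the maximum number of pairwise arc-disjoint directed $xy$-paths, $\lambda(D)=\max_{x\ne y}\lambda_D(x,y)$. $D$ is strong if there is a directed path between any ordered pair of vertices, biconnected if its underlying graph is connected with no cutvertex, and $k$-extremal if it is biconnected, strong and $\vec{\chi}(D)=\lambda(D)+1=k+1$. -}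

module Defs where

open import Data.Nat using (ℕ; zero; suc; _≤_)
open import Data.Fin using (Fin; _≟_)
open import Data.Bool using (Bool; true; false; _∧_; _∨_; if_then_else_)
open import Data.List using (List; []; _∷_; length)
open import Data.List.Relation.Unary.All using (All)
open import Data.List.Relation.Unary.Unique.Propositional using (Unique)
open import Data.List.Membership.Propositional using (_∈_)
open import Data.Product using (Σ; ∃; ∃-syntax; _×_; _,_)
open import Relation.Nullary using (¬_)
open import Data.Empty using (⊥)
open import Relation.Nullary.Decidable using (⌊_⌋)
open import Relation.Binary.PropositionalEquality using (_≡_; _≢_; refl)

-- A digraph on vertex set Fin n: no loops, no parallel arcs (arc relation is
-- Bool-valued), digons allowed.
record Digraph : Set where
  field
    n        : ℕ
    arc      : Fin n → Fin n → Bool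
    loopless : ∀ x → arc x x ≡ false
open Digraph public

Vertex : Digraph → Set
Vertex D = Fin (n D)

data IsWalk {m : ℕ} (A : Fin m → Fin m → Bool) : Fin m → Fin m → List (Fin m) → Set where
  single : ∀ x → IsWalk A x x (x ∷ [])
  cons   : ∀ {x y z vs} → A x y ≡ true → IsWalk A y z (y ∷ vs) → IsWalk A x z (x ∷ y ∷ vs)

IsPath : (D : Digraph) → Vertex D → Vertex D → List (Vertex D) → Set
IsPath D x y vs = IsWalk (arc D) x y vs × Unique vs

IsCycle : (D : Digraph) → List (Vertex D) → Set
IsCycle D vs = Σ (Vertex D) λ x → Σ (Vertex D) λ y →
  IsWalk (arc D) x y vs × arc D y x ≡ true × Unique vs × 2 ≤ length vs

arcsOf : {m : ℕ} → List (Fin m) → List (Fin m × Fin m)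
arcsOf []           = []
arcsOf (x ∷ [])     = []
arcsOf (x ∷ y ∷ vs) = (x , y) ∷ arcsOf (y ∷ vs)

ArcDisjoint : {m : ℕ} → List (Fin m) → List (Fin m) → Set
ArcDisjoint p q = ∀ a → a ∈ arcsOf p → a ∈ arcsOf q → ⊥

ArcDisjointPaths : (D : Digraph) → Vertex D → Vertex D → ℕ → Set
ArcDisjointPaths D x y m =
  Σ (Fin m → List (Vertex D)) λ ps →
    (∀ i → IsPath D x y (ps i)) × (∀ i j → i ≢ j → ArcDisjoint (ps i) (ps j))

-- λ(D) = k : λ_D(x,y) ≤ k for all x ≠ y, attained for some x ≠ y.
LambdaEq : Digraph → ℕ → Set
LambdaEq D k =
  (Σ (Vertex D) λ x → Σ (Vertex D) λ y → x ≢ y × ArcDisjointPaths D x y k)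
  × (∀ x y m → x ≢ y → ArcDisjointPaths D x y m → m ≤ k)

Monochromatic : {m k : ℕ} → (Fin m → Fin k) → List (Fin m) → Set
Monochromatic {k = k} c vs = Σ (Fin k) λ col → All (λ z → c z ≡ col) vs

-- k-dicolouring: every colour class induces an acyclic subdigraph,
-- i.e. there is no monochromatic directed cycle.
IsDicolouring : (D : Digraph) (k : ℕ) → (Vertex D → Fin k) → Set
IsDicolouring D k c = ∀ vs → IsCycle D vs → ¬ Monochromatic c vs

Dicolourable : Digraph → ℕ → Set
Dicolourable D k = Σ (Vertex D → Fin k) λ c → IsDicolouring D k c

DichromaticEq : Digraph → ℕ → Set
DichromaticEq D k = Dicolourable D k × (∀ j → Dicolourable D j → k ≤ j)

Strong : Digraph → Set
Strong D = ∀ x y → Σ (List (Vertex D)) λ vs → IsPath D x y vs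

underlying : (D : Digraph) → Vertex D → Vertex D → Bool
underlying D x y = arc D x y ∨ arc D y x

-- Underlying graph connected, and no cutvertex (removing any vertex z leaves
-- the remaining vertices mutually reachable in the underlying graph).
Biconnected : Digraph → Set
Biconnected D =
  (∀ x y → Σ (List (Vertex D)) λ vs → IsWalk (underlying D) x y vs)
  × (∀ z x y → x ≢ z → y ≢ z →
       Σ (List (Vertex D)) λ vs → IsWalk (underlying D) x y vs × All (λ w → w ≢ z) vs)

-- k-extremal: biconnected, strong, χ(D) = λ(D) + 1 = k + 1.
Extremal : ℕ → Digraph → Set
Extremal k D = Biconnected D × Strong D × DichromaticEq D (suc k) × LambdaEq D k

removeArcs : (D : Digraph) → Vertex D → Vertex D → Vertex D → Vertex D → Bool
removeArcs D u v x y =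
  if (⌊ x ≟ u ⌋ ∧ ⌊ y ≟ v ⌋) ∨ (⌊ x ≟ v ⌋ ∧ ⌊ y ≟ u ⌋) then false else arc D x y

removeArcs-loopless : (D : Digraph) (u v : Vertex D) → ∀ x → removeArcs D u v x x ≡ false
removeArcs-loopless D u v x
  with (⌊ x ≟ u ⌋ ∧ ⌊ x ≟ v ⌋) ∨ (⌊ x ≟ v ⌋ ∧ ⌊ x ≟ u ⌋)
... | true  = refl
... | false = loopless D x

removeDigon : (D : Digraph) → Vertex D → Vertex D → Digraph
removeDigon D u v = record
  { n = n D ; arc = removeArcs D u v ; loopless = removeArcs-loopless D u v }

MonoPath : (D : Digraph) {k : ℕ} → (Vertex D → Fin k) → Vertex D → Vertex D → Set
MonoPath D c x y = Σ (List (Vertex D)) λ vs → IsPath D x y vs × Monochromatic c vs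

-- Everything rests on one gluing step: if fewer than k colour pairs occur on the arcs leaving a
-- vertex set X, then dicolourings of X and of its complement combine into one after rotating the
-- colours outside X cyclically so as to avoid all those pairs.
--
-- A monochromatic u-v path P in a k-dicolouring of D − [u,v] is impossible: as λ(D) = k, Menger's
-- theorem gives a u-v cut of at most k arcs; it contains uv and an arc of P, both coloured
-- (col, col), so at most k − 1 colour pairs cross it and gluing the colouring with itself would
-- k-dicolour D.
--
-- D − [u,v] is k-dicolourable: every vertex set S with two vertices contains x ≠ y joined by a
-- path of D using no arc of (D − [u,v])[S] (the arc uv, or an ear through a vertex outside S,
-- which exists as D is strong and biconnected), so x and y are separated in (D − [u,v])[S] by
-- fewer than k arcs and the gluing step applies by induction on |S|. In such a colouring u and v
-- get the same colour, since otherwise it would k-dicolour D, and a monochromatic cycle of D of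
-- length at least 3 through u and v would contain a monochromatic u-v or v-u path of D − [u,v].

module Submission where

open import Defs
open import Data.Bool using (Bool; true; false; _∧_; _∨_; not; if_then_else_)
import Data.Bool.Properties as Bool
open import Data.Empty using (⊥; ⊥-elim)
open import Data.Fin using (Fin; zero; suc; _≟_; toℕ; fromℕ<) renaming (_<_ to _<ᶠ_)
open import Data.Fin.Properties using (any?; pigeonhole; toℕ-fromℕ<; toℕ-injective; toℕ<n)
  renaming (suc-injective to Fin-suc-injective; <⇒≢ to <ᶠ⇒≢)
open import Data.List using (List; []; _∷_; _++_; [_]; length; map; filter; lookup)
open import Data.List.Properties using (++-assoc; ++-identityʳ; length-++; length-map; filter-notAll)
open import Data.List.Membership.Propositional using (_∈_; _∉_; find)
open import Data.List.Membership.Propositional.Properties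
  using (∈-map⁺; ∈-filter⁺; ∈-∃++; ∈-++⁻; ∈-++⁺ˡ; ∈-++⁺ʳ)
open import Data.List.Relation.Binary.Disjoint.Propositional using (Disjoint)
open import Data.List.Relation.Binary.Subset.Propositional using (_⊆_)
open import Data.List.Relation.Unary.All using (All; []; _∷_)
import Data.List.Relation.Unary.All as All
import Data.List.Relation.Unary.All.Properties as All
open import Data.List.Relation.Unary.AllPairs using ([]; _∷_)
open import Data.List.Relation.Unary.Any using (Any; here; there; index)
import Data.List.Relation.Unary.Any as Any
open import Data.List.Relation.Unary.Any.Properties using (lookup-index)
open import Data.List.Relation.Unary.Unique.Propositional using (Unique)
import Data.List.Relation.Unary.Unique.Propositional.Properties as Unique
open import Data.Nat using (ℕ; zero; suc; _+_; _∸_; _≤_; _<_; z≤n; s≤s; NonZero)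
open import Data.Nat.DivMod using (_%_; m%n<n; %-distribˡ-+; m%n%n≡m%n; [m+n]%n≡m%n; m<n⇒m%n≡m)
open import Data.Nat.Properties
  using ( +-0-commutativeMonoid; +-commutativeSemigroup; +-assoc; +-comm; +-suc; +-identityʳ
        ; +-cancelʳ-≡; +-cancelˡ-≡; +-mono-≤; +-mono-<-≤; +-mono-≤-<; m+[n∸m]≡n; 1+n≢0
        ; ≤-refl; ≤-reflexive; ≤-pred; m≤n⇒m≤1+n; m≤n+m; <⇒≤; <⇒≱; <-≤-trans; n≮n )
open import Data.Nat.Tactic.RingSolver using (solve-∀)
open import Algebra.Properties.CommutativeMonoid.Sum +-0-commutativeMonoid
  using (sum; sum-cong-≗; ∑-distrib-+; ∑-comm)
open import Algebra.Properties.CommutativeSemigroup +-commutativeSemigroup using (xy∙z≈xz∙y)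
open import Data.Product using (Σ; ∃; ∃₂; _×_; _,_; proj₁; proj₂; map₁)
open import Data.Product.Properties using (≡-dec)
open import Data.Sum using (_⊎_; inj₁; inj₂)
import Data.Sum as Sum
open import Function using (_∘_; flip; Injective)
open import Relation.Nullary using (Dec; yes; no; ¬_; contradiction)
open import Relation.Nullary.Decidable using (⌊_⌋; ¬?; _×-dec_)
open import Relation.Binary.PropositionalEquality hiding ([_])

BoolRel : ℕ → Set
BoolRel m = Fin m → Fin m → Bool

private variable
  m k K : ℕ
  A B f g : BoolRel m
  a b s t u v w x y z : Fin m
  vs ws : List (Fin m)
  sink source : Fin m → ℕ

true≢false : ∀ {p} → p ≡ true → p ≢ false
true≢false refl ()

∧-trueˡ : ∀ {p q} → p ∧ q ≡ true → p ≡ true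
∧-trueˡ {true} _ = refl

-- Walks, paths and cycles

walk-head : IsWalk A x y vs → x ∈ vs
walk-head (single x) = here refl
walk-head (cons _ _) = here refl

walk-last : IsWalk A x y vs → y ∈ vs
walk-last (single x) = here refl
walk-last (cons _ w) = there (walk-last w)

walk-arc : IsWalk A x y vs → (a , b) ∈ arcsOf vs → A a b ≡ true
walk-arc (cons e w) (here refl) = e
walk-arc (cons e w) (there ab) = walk-arc w ab

arcsOf-endpoints : (a , b) ∈ arcsOf vs → a ∈ vs × b ∈ vs
arcsOf-endpoints {vs = _ ∷ _ ∷ _} (here refl) = here refl , there (here refl)
arcsOf-endpoints {vs = _ ∷ _ ∷ _} (there ab) =
  let a∈ , b∈ = arcsOf-endpoints ab in there a∈ , there b∈

walk-mapᵃ : (∀ {a b} → (a , b) ∈ arcsOf vs → A a b ≡ true → B a b ≡ true) →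
            IsWalk A x y vs → IsWalk B x y vs
walk-mapᵃ h (single x) = single x
walk-mapᵃ h (cons e w) = cons (h (here refl) e) (walk-mapᵃ (λ ab → h (there ab)) w)

walk-map : (∀ {a b} → A a b ≡ true → B a b ≡ true) → IsWalk A x y vs → IsWalk B x y vs
walk-map h = walk-mapᵃ (λ _ → h)

walk-mapᵛ : (∀ {a b} → a ∈ vs → b ∈ vs → A a b ≡ true → B a b ≡ true) →
            IsWalk A x y vs → IsWalk B x y vs
walk-mapᵛ h = walk-mapᵃ (λ ab → let a∈ , b∈ = arcsOf-endpoints ab in h a∈ b∈)

walk-cons : A x y ≡ true → IsWalk A y z vs → IsWalk A x z (x ∷ vs)
walk-cons e (single _) = cons e (single _)
walk-cons e (cons e′ w) = cons e (cons e′ w)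

walk-snoc : IsWalk A x y vs → A y z ≡ true → IsWalk A x z (vs ++ [ z ])
walk-snoc (single _) e = cons e (single _)
walk-snoc (cons e′ w) e = cons e′ (walk-snoc w e)

walk-split : ∀ us {ws} → IsWalk A x y (us ++ z ∷ ws) →
             IsWalk A x z (us ++ [ z ]) × IsWalk A z y (z ∷ ws)
walk-split [] (single _) = single _ , single _
walk-split [] (cons e w) = single _ , cons e w
walk-split (_ ∷ []) (cons e w) = cons e (single _) , w
walk-split (_ ∷ u ∷ us) (cons e w) = let p , q = walk-split (u ∷ us) w in cons e p , q

walk-join : ∀ us {ws} → IsWalk A x z (us ++ [ z ]) → IsWalk A z y (z ∷ ws) →
            IsWalk A x y (us ++ z ∷ ws)
walk-join [] (single _) q = q
walk-join (_ ∷ []) (cons e (single _)) q = cons e q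
walk-join (_ ∷ u ∷ us) (cons e p) q = cons e (walk-join (u ∷ us) p q)

walk-trans : IsWalk A x y vs → IsWalk A y z ws → ∃ λ us → IsWalk A x z us
walk-trans (single _) q = _ , q
walk-trans (cons e p) q = let _ , r = walk-trans p q in _ , walk-cons e r

walk-suffix : IsWalk A x y vs → z ∈ vs →
              ∃ λ ws → IsWalk A z y ws × ws ⊆ vs × (Unique vs → Unique ws)
walk-suffix w@(single _) (here refl) = _ , w , (λ p → p) , (λ u → u)
walk-suffix w@(cons _ _) (here refl) = _ , w , (λ p → p) , (λ u → u)
walk-suffix (cons e w) (there z∈) =
  let ws , w′ , ⊆vs , uniq = walk-suffix w z∈
  in ws , w′ , (λ p → there (⊆vs p)) , (λ { (_ ∷ u) → uniq u })

walk⇒path : IsWalk A x y vs → ∃ λ ps → IsWalk A x y ps × Unique ps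
walk⇒path (single x) = _ , single x , [] ∷ []
walk⇒path {x = x} (cons e w) with walk⇒path w
... | ps , p , uniq with Any.any? (x ≟_) ps
...   | yes x∈ = let ws , w′ , _ , uniq′ = walk-suffix p x∈ in ws , w′ , uniq′ uniq
...   | no x∉ = x ∷ ps , walk-cons e p , All.¬Any⇒All¬ ps x∉ ∷ uniq

-- Cycle, Dicolours and DisjointPaths applied to arc D unfold to IsCycle D, IsDicolouring D
-- and ArcDisjointPaths D.
Cycle : BoolRel m → List (Fin m) → Set
Cycle {m} A vs = Σ (Fin m) λ x → Σ (Fin m) λ y → IsWalk A x y vs × A y x ≡ true × Unique vs × 2 ≤ length vs

cycle-map : (∀ {a b} → a ∈ vs → b ∈ vs → A a b ≡ true → B a b ≡ true) → Cycle A vs → Cycle B vs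
cycle-map h (x , y , w , yx , uniq , len) = x , y , walk-mapᵛ h w , h (walk-last w) (walk-head w) yx , uniq , len

ExitArc : BoolRel m → (Fin m → Bool) → List (Fin m) → Set
ExitArc A X vs = ∃₂ λ p q → A p q ≡ true × X p ≡ true × X q ≡ false × p ∈ vs × q ∈ vs

exit-⊆ : ∀ {X} → vs ⊆ ws → ExitArc A X vs → ExitArc A X ws
exit-⊆ vs⊆ws (p , q , pq , Xp , Xq , p∈ , q∈) = p , q , pq , Xp , Xq , vs⊆ws p∈ , vs⊆ws q∈

walk-exit : ∀ X → IsWalk A x y vs → X x ≡ true → X y ≡ false → ExitArc A X vs
walk-exit X (single _) Xx Xy = contradiction Xy (true≢false Xx)
walk-exit X (cons {y = y′} e w) Xx Xy with X y′ in Xy′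
... | false = _ , _ , e , Xx , Xy′ , here refl , there (walk-head w)
... | true  = exit-⊆ there (walk-exit X w Xy′ Xy)

walk-exit-before : ∀ X → IsWalk A x y vs → X x ≡ true → z ∈ vs → X z ≡ false → ExitArc A X vs
walk-exit-before X (single _) Xx (here refl) Xz = contradiction Xz (true≢false Xx)
walk-exit-before X (cons _ _) Xx (here refl) Xz = contradiction Xz (true≢false Xx)
walk-exit-before X (cons {y = y′} e w) Xx (there z∈) Xz with X y′ in Xy′
... | false = _ , _ , e , Xx , Xy′ , here refl , there (walk-head w)
... | true  = exit-⊆ there (walk-exit-before X w Xy′ z∈ Xz)

walk-exit-after : ∀ X → IsWalk A x y vs → X y ≡ false → z ∈ vs → X z ≡ true → ExitArc A X vs
walk-exit-after X w Xy z∈ Xz =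
  let _ , w′ , ⊆vs , _ = walk-suffix w z∈ in exit-⊆ ⊆vs (walk-exit X w′ Xz Xy)

-- Finite sums, counting and reachability

sum-zero : {g : Fin m → ℕ} → (∀ x → g x ≡ 0) → sum g ≡ 0
sum-zero {zero} _ = refl
sum-zero {suc m} g≡0 rewrite g≡0 zero = sum-zero (λ x → g≡0 (suc x))

sum-point : (z : Fin m) {g : Fin m → ℕ} → (∀ x → x ≢ z → g x ≡ 0) → sum g ≡ g z
sum-point {suc m} zero {g} g≡0 =
  trans (cong (g zero +_) (sum-zero (λ x → g≡0 (suc x) λ ()))) (+-identityʳ _)
sum-point {suc m} (suc z) g≡0 rewrite g≡0 zero (λ ()) =
  sum-point z (λ x x≢z → g≡0 (suc x) (x≢z ∘ Fin-suc-injective))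

sum-suc-at : (z : Fin m) {g h : Fin m → ℕ} →
             (∀ x → x ≢ z → g x ≡ h x) → g z ≡ suc (h z) → sum g ≡ suc (sum h)
sum-suc-at {suc m} zero {g} {h} g≡h gz rewrite gz =
  cong (λ w → suc (h zero + w)) (sum-cong-≗ (λ x → g≡h (suc x) λ ()))
sum-suc-at {suc m} (suc z) {g} {h} g≡h gz rewrite g≡h zero (λ ()) =
  trans (cong (h zero +_) (sum-suc-at z (λ x x≢z → g≡h (suc x) (x≢z ∘ Fin-suc-injective)) gz))
        (+-suc (h zero) _)

sum-mono-≤ : {g h : Fin m → ℕ} → (∀ x → g x ≤ h x) → sum g ≤ sum h
sum-mono-≤ {zero} _ = z≤n
sum-mono-≤ {suc m} g≤h = +-mono-≤ (g≤h zero) (sum-mono-≤ (λ x → g≤h (suc x)))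

sum-mono-< : {g h : Fin m → ℕ} → (∀ x → g x ≤ h x) → (z : Fin m) → g z < h z → sum g < sum h
sum-mono-< g≤h zero gz<hz = +-mono-<-≤ gz<hz (sum-mono-≤ (λ x → g≤h (suc x)))
sum-mono-< g≤h (suc z) gz<hz = +-mono-≤-< (g≤h zero) (sum-mono-< (λ x → g≤h (suc x)) z gz<hz)

bit : Bool → ℕ
bit true  = 1
bit false = 0

count : (Fin m → Bool) → ℕ
count P = sum (λ x → bit (P x))

count≤ : (P : Fin m → Bool) → count P ≤ m
count≤ {zero} P = z≤n
count≤ {suc m} P = +-mono-≤ (bit≤1 (P zero)) (count≤ (λ x → P (suc x)))
  where
  bit≤1 : ∀ b → bit b ≤ 1
  bit≤1 true  = s≤s z≤n
  bit≤1 false = z≤n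

count-⊂ : {P Q : Fin m → Bool} → (∀ {x} → P x ≡ true → Q x ≡ true) →
          P z ≡ false → Q z ≡ true → count P < count Q
count-⊂ {z = z} {P} {Q} P⊆Q Pz Qz = sum-mono-< bit≤ z (bit< Pz Qz)
  where
  bit≤ : ∀ x → bit (P x) ≤ bit (Q x)
  bit≤ x with P x in Px | Q x in Qx
  ... | false | _     = z≤n
  ... | true  | true  = ≤-refl
  ... | true  | false = contradiction Qx (true≢false (P⊆Q Px))
  bit< : ∀ {p q} → p ≡ false → q ≡ true → bit p < bit q
  bit< refl refl = s≤s z≤n

count-cong : {P Q : Fin m → Bool} → (∀ x → P x ≡ Q x) → count P ≡ count Q
count-cong P≡Q = sum-cong-≗ (λ x → cong bit (P≡Q x))

insert : Fin m → (Fin m → Bool) → Fin m → Bool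
insert b P x = ⌊ x ≟ b ⌋ ∨ P x

count-insert : {P : Fin m → Bool} → P b ≡ false → count (insert b P) ≡ suc (count P)
count-insert {b = b} {P} Pb = sum-suc-at b off at
  where
  off : ∀ x → x ≢ b → bit (insert b P x) ≡ bit (P x)
  off x x≢b with x ≟ b
  ... | yes x≡b = contradiction x≡b x≢b
  ... | no _    = refl
  at : bit (insert b P b) ≡ suc (bit (P b))
  at rewrite Pb with b ≟ b
  ... | yes _   = refl
  ... | no b≢b  = contradiction refl b≢b

Closed : BoolRel m → (Fin m → Bool) → Set
Closed A R = ∀ {a b} → R a ≡ true → A a b ≡ true → R b ≡ true

closed-walk : ∀ {R} → Closed A R → IsWalk A x y vs → R x ≡ true → R y ≡ true
closed-walk closed (single _) Rx = Rx
closed-walk closed (cons e w) Rx = closed-walk closed w (closed Rx e)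

record Reach (A : BoolRel m) (s : Fin m) : Set where
  field
    R       : Fin m → Bool
    s∈R     : R s ≡ true
    walk-to : ∀ {z} → R z ≡ true → ∃ λ vs → IsWalk A s z vs
    closed  : Closed A R

reach : (A : BoolRel m) (s : Fin m) → Reach A s
reach {m} A s = grow m (insert s (λ _ → false)) (m≤n+m m _) (insert-self s) start-walk
  where
  insert-self : ∀ {P} b → insert b P b ≡ true
  insert-self b with b ≟ b
  ... | yes _  = refl
  ... | no b≢b = contradiction refl b≢b

  start-walk : ∀ {z} → insert s (λ _ → false) z ≡ true → ∃ λ vs → IsWalk A s z vs
  start-walk {z} z∈ with z ≟ s
  start-walk {z} z∈ | yes refl = _ , single z

  -- Each round adds a new vertex, so the fuel m suffices.
  grow : (fuel : ℕ) (R : Fin m → Bool) → m ≤ count R + fuel → R s ≡ true →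
         (∀ {z} → R z ≡ true → ∃ λ vs → IsWalk A s z vs) → Reach A s
  grow fuel R bound s∈R walk-to
    with any? (λ a → any? (λ b → (R a Bool.≟ true) ×-dec (R b Bool.≟ false) ×-dec (A a b Bool.≟ true)))
  ... | no none = record { R = R ; s∈R = s∈R ; walk-to = walk-to ; closed = closed }
    where
    closed : Closed A R
    closed {a} {b} Ra ab with R b in Rb
    ... | true  = refl
    ... | false = contradiction (a , b , Ra , Rb , ab) none
  ... | yes (a , b , Ra , Rb , ab) with fuel
  ...   | zero = contradiction (subst (m ≤_) (+-identityʳ _) bound)
                                (<⇒≱ (subst (_≤ m) (count-insert {P = R} Rb) (count≤ (insert b R))))
  ...   | suc fuel = grow fuel (insert b R) bound′ (⊆insert s∈R) walk-to′
    where
    ⊆insert : ∀ {z} → R z ≡ true → insert b R z ≡ true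
    ⊆insert {z} Rz rewrite Rz = Bool.∨-zeroʳ _
    bound′ : m ≤ count (insert b R) + fuel
    bound′ = subst (m ≤_) (trans (+-suc _ fuel) (cong (_+ fuel) (sym (count-insert {P = R} Rb)))) bound
    walk-to′ : ∀ {z} → insert b R z ≡ true → ∃ λ vs → IsWalk A s z vs
    walk-to′ {z} z∈ with z ≟ b
    ... | yes refl = let _ , w = walk-to Ra in _ , walk-snoc w ab
    ... | no _     = walk-to z∈

-- Flows and Menger's theorem

_⊆ᴬ_ : BoolRel m → BoolRel m → Set
f ⊆ᴬ g = ∀ x y → f x y ≡ true → g x y ≡ true

δ : Fin m → ℕ → Fin m → ℕ
δ a K x = if ⌊ x ≟ a ⌋ then K else 0

_+ᶠ_ : (Fin m → ℕ) → (Fin m → ℕ) → Fin m → ℕ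
(g +ᶠ h) x = g x + h x

δ-at : (a : Fin m) (K : ℕ) → δ a K a ≡ K
δ-at a K with a ≟ a
... | yes _   = refl
... | no a≢a  = contradiction refl a≢a

δ-off : x ≢ a → δ a K x ≡ 0
δ-off {x = x} {a} x≢a with x ≟ a
... | yes x≡a = contradiction x≡a x≢a
... | no _    = refl

δ-+1 : (a : Fin m) (K : ℕ) (x : Fin m) → δ a K x + δ a 1 x ≡ δ a (suc K) x
δ-+1 a K x with x ≟ a
... | yes _ = +-comm K 1
... | no _  = refl

set : BoolRel m → Fin m → Fin m → Bool → BoolRel m
set f a b v x y = if ⌊ x ≟ a ⌋ ∧ ⌊ y ≟ b ⌋ then v else f x y

set-at : ∀ (f : BoolRel m) a b v → set f a b v a b ≡ v
set-at f a b v with a ≟ a | b ≟ b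
... | yes _ | yes _ = refl
... | no a≢a | _    = contradiction refl a≢a
... | yes _ | no b≢b = contradiction refl b≢b

set-off : ∀ (f : BoolRel m) {a b} v → x ≢ a ⊎ y ≢ b → set f a b v x y ≡ f x y
set-off {x = x} {y} f {a} {b} v off with x ≟ a | y ≟ b | off
... | no _    | _       | _         = refl
... | yes _   | no _    | _         = refl
... | yes x≡a | yes _   | inj₁ x≢a  = contradiction x≡a x≢a
... | yes _   | yes y≡b | inj₂ y≢b  = contradiction y≡b y≢b

out inn : BoolRel m → Fin m → ℕ
out f x = count (f x)
inn f = out (flip f)

set-set : f a b ≡ true → ∀ x y → set (set f a b false) a b true x y ≡ f x y
set-set {a = a} {b} fab x y with x ≟ a | y ≟ b
... | yes refl | yes refl = sym fab
... | yes _    | no _     = refl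
... | no _     | _        = refl

set-flip : ∀ (f : BoolRel m) a b v → set f a b v y x ≡ set (flip f) b a v x y
set-flip {y = y} {x} f a b v =
  cong (λ c → if c then v else f y x) (Bool.∧-comm ⌊ y ≟ a ⌋ ⌊ x ≟ b ⌋)

out-add : f a b ≡ false → ∀ x → out (set f a b true) x ≡ out f x + δ a 1 x
out-add {f = f} {a} {b} fab x = by (x ≟ a)
  where
  row-off : ∀ y → y ≢ b → bit (set f a b true a y) ≡ bit (f a y)
  row-off y y≢b = cong bit (set-off f true (inj₂ y≢b))
  row-at : bit (set f a b true a b) ≡ suc (bit (f a b))
  row-at rewrite set-at f a b true | fab = refl
  by : Dec (x ≡ a) → out (set f a b true) x ≡ out f x + δ a 1 x
  by (yes refl) = trans (sum-suc-at b row-off row-at)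
                        (trans (+-comm 1 _) (cong (out f a +_) (sym (δ-at a 1))))
  by (no x≢a) = trans (count-cong {P = set f a b true x} (λ y → set-off f true (inj₁ x≢a)))
                      (trans (sym (+-identityʳ _)) (cong (out f x +_) (sym (δ-off x≢a))))

inn-add : f a b ≡ false → ∀ x → inn (set f a b true) x ≡ inn f x + δ b 1 x
inn-add {f = f} {a} {b} fab x =
  trans (count-cong {P = λ y → set f a b true y x} (λ y → set-flip f a b true)) (out-add {f = flip f} fab x)

out-remove : f a b ≡ true → ∀ x → out f x ≡ out (set f a b false) x + δ a 1 x
out-remove {f = f} {a} {b} fab x =
  trans (count-cong {P = f x} (λ y → sym (set-set fab x y))) (out-add {f = set f a b false} (set-at f a b false) x)

inn-remove : f a b ≡ true → ∀ x → inn f x ≡ inn (set f a b false) x + δ b 1 x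
inn-remove {f = f} {a} {b} fab x =
  trans (count-cong {P = λ y → f y x} (λ y → sym (set-set {f = flip f} fab x y)))
        (trans (out-add {f = set (flip f) b a false} (set-at (flip f) b a false) x)
               (cong (_+ δ b 1 x) (count-cong {Q = λ y → set f a b false y x} (λ y → sym (set-flip f a b false)))))

-- A flow is a set f of arcs carrying one unit each; sink and source are external demand and supply.
Balanced : BoolRel m → (Fin m → ℕ) → (Fin m → ℕ) → Set
Balanced f sink source = ∀ x → out f x + sink x ≡ inn f x + source x

balanced-cong : {sink′ source′ : Fin m → ℕ} →
                (∀ x → sink x ≡ sink′ x) → (∀ x → source x ≡ source′ x) →
                Balanced f sink source → Balanced f sink′ source′
balanced-cong {f = f} sink≡ source≡ bal x =
  trans (cong (out f x +_) (sym (sink≡ x))) (trans (bal x) (cong (inn f x +_) (source≡ x)))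

balanced-cancel : {g : Fin m → ℕ} → Balanced f (sink +ᶠ g) (source +ᶠ g) → Balanced f sink source
balanced-cancel {f = f} {sink} {source} {g} bal x = +-cancelʳ-≡ (g x) _ _ (begin
  out f x + sink x + g x      ≡⟨ +-assoc (out f x) _ _ ⟩
  out f x + (sink x + g x)    ≡⟨ bal x ⟩
  inn f x + (source x + g x)  ≡⟨ +-assoc (inn f x) _ _ ⟨
  inn f x + source x + g x    ∎)
  where open ≡-Reasoning

add-arc-shifts-sink : f a b ≡ false → Balanced f (sink +ᶠ δ a 1) source →
                   Balanced (set f a b true) (sink +ᶠ δ b 1) source
add-arc-shifts-sink {f = f} {a} {b} {sink = sink} {source} fab bal x = begin
  out (set f a b true) x + (sink x + δ b 1 x)  ≡⟨ cong (_+ _) (out-add fab x) ⟩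
  out f x + δ a 1 x + (sink x + δ b 1 x)       ≡⟨ shuffle (out f x) _ _ _ ⟩
  out f x + (sink x + δ a 1 x) + δ b 1 x       ≡⟨ cong (_+ δ b 1 x) (bal x) ⟩
  inn f x + source x + δ b 1 x                 ≡⟨ xy∙z≈xz∙y (inn f x) _ _ ⟩
  inn f x + δ b 1 x + source x                 ≡⟨ cong (_+ source x) (inn-add fab x) ⟨
  inn (set f a b true) x + source x            ∎
  where
  open ≡-Reasoning
  shuffle : ∀ o d s e → o + d + (s + e) ≡ o + (s + d) + e
  shuffle = solve-∀

remove-arc-shifts-sink : f b a ≡ true → Balanced f (sink +ᶠ δ a 1) source →
                      Balanced (set f b a false) (sink +ᶠ δ b 1) source
remove-arc-shifts-sink {f = f} {b} {a} {sink = sink} {source} fba bal x =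
  +-cancelʳ-≡ (δ a 1 x) _ _ (begin
    out f′ x + (sink x + δ b 1 x) + δ a 1 x  ≡⟨ shuffle (out f′ x) _ _ _ ⟩
    out f′ x + δ b 1 x + (sink x + δ a 1 x)  ≡⟨ cong (_+ _) (out-remove fba x) ⟨
    out f x + (sink x + δ a 1 x)             ≡⟨ bal x ⟩
    inn f x + source x                       ≡⟨ cong (_+ source x) (inn-remove fba x) ⟩
    inn f′ x + δ a 1 x + source x            ≡⟨ xy∙z≈xz∙y (inn f′ x) _ _ ⟩
    inn f′ x + source x + δ a 1 x            ∎)
  where
  open ≡-Reasoning
  f′ : BoolRel _
  f′ = set f b a false
  shuffle : ∀ o s e d → o + (s + e) + d ≡ o + e + (s + d)
  shuffle = solve-∀

remove-arc-shifts-source : f a b ≡ true → Balanced f sink (source +ᶠ δ a 1) →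
                       Balanced (set f a b false) sink (source +ᶠ δ b 1)
remove-arc-shifts-source {f = f} {a} {b} {sink = sink} {source} fab bal x =
  +-cancelʳ-≡ (δ a 1 x) _ _ (begin
    out f′ x + sink x + δ a 1 x                 ≡⟨ xy∙z≈xz∙y (out f′ x) _ _ ⟩
    out f′ x + δ a 1 x + sink x                 ≡⟨ cong (_+ sink x) (out-remove fab x) ⟨
    out f x + sink x                            ≡⟨ bal x ⟩
    inn f x + (source x + δ a 1 x)              ≡⟨ cong (_+ _) (inn-remove fab x) ⟩
    inn f′ x + δ b 1 x + (source x + δ a 1 x)   ≡⟨ shuffle (inn f′ x) _ _ _ ⟩
    inn f′ x + (source x + δ b 1 x) + δ a 1 x   ∎)
  where
  open ≡-Reasoning
  f′ : BoolRel _
  f′ = set f a b false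
  shuffle : ∀ i e s d → i + e + (s + d) ≡ i + (s + e) + d
  shuffle = solve-∀

set-⊆ : ∀ a b v → f ⊆ᴬ A → (v ≡ true → A a b ≡ true) → set f a b v ⊆ᴬ A
set-⊆ a b v f⊆A v⇒ab x y h with x ≟ a | y ≟ b
... | yes refl | yes refl = v⇒ab h
... | yes _    | no _     = f⊆A x y h
... | no _     | _        = f⊆A x y h

set-false-⊆ : ∀ a b → set f a b false ⊆ᴬ f
set-false-⊆ a b = set-⊆ a b false (λ _ _ h → h) λ ()

residual : BoolRel m → BoolRel m → BoolRel m
residual A f x y = (A x y ∧ not (f x y)) ∨ f y x

push : BoolRel m → BoolRel m → Fin m → Fin m → BoolRel m
push A f a b = if A a b ∧ not (f a b) then set f a b true else set f b a false

∧-not : ∀ {p q} → p ∧ not q ≡ true → p ≡ true × q ≡ false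
∧-not {true} {false} refl = refl , refl

push-⊆ : f ⊆ᴬ A → push A f a b ⊆ᴬ A
push-⊆ {f = f} {A = A} {a = a} {b = b} f⊆A with A a b ∧ not (f a b) in e
... | true  = set-⊆ a b true f⊆A (λ _ → proj₁ (∧-not e))
... | false = set-⊆ b a false f⊆A λ ()

push-balanced : residual A f a b ≡ true → Balanced f (sink +ᶠ δ a 1) source →
                Balanced (push A f a b) (sink +ᶠ δ b 1) source
push-balanced {A = A} {f = f} {a = a} {b = b} r bal with A a b ∧ not (f a b) in e
... | true  = add-arc-shifts-sink (proj₂ (∧-not e)) bal
... | false = remove-arc-shifts-sink r bal

push-local : x ≢ a → y ≢ a → push A f a b x y ≡ f x y
push-local {a = a} {A = A} {f = f} {b = b} x≢a y≢a with A a b ∧ not (f a b)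
... | true  = set-off f true (inj₁ x≢a)
... | false = set-off f false (inj₂ y≢a)

augment : IsWalk (residual A f) w t vs → Unique vs → f ⊆ᴬ A → Balanced f (sink +ᶠ δ w 1) source →
          ∃ λ f′ → f′ ⊆ᴬ A × Balanced f′ (sink +ᶠ δ t 1) source
augment (single _) _ f⊆A bal = _ , f⊆A , bal
augment {A = A} {f} (cons {x = w} {y = w′} e rest) (w∉ ∷ uniq) f⊆A bal =
  augment (walk-mapᵛ unchanged rest) uniq (push-⊆ {f = f} {A = A} f⊆A) (push-balanced {A = A} e bal)
  where
  unchanged : ∀ {x y} → x ∈ _ → y ∈ _ → residual A f x y ≡ true → residual A (push A f w w′) x y ≡ true
  unchanged {x} {y} x∈ y∈ r =
    let x≢w = ≢-sym (All.lookup w∉ x∈) ; y≢w = ≢-sym (All.lookup w∉ y∈)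
    in trans (cong₂ (λ p q → (A x y ∧ not p) ∨ q) (local x≢w y≢w) (local y≢w x≢w)) r
    where
    local : ∀ {x y} → x ≢ w → y ≢ w → push A f w w′ x y ≡ f x y
    local = push-local {A = A} {f = f} {b = w′}

remove-walk : IsWalk f w t vs → Unique vs → Balanced f sink (source +ᶠ δ w 1) →
              ∃ λ f′ → f′ ⊆ᴬ f × Balanced f′ sink (source +ᶠ δ t 1) ×
                       (∀ {a b} → (a , b) ∈ arcsOf vs → f′ a b ≡ false)
remove-walk (single _) _ bal = _ , (λ _ _ h → h) , bal , λ ()
remove-walk {f = f} (cons {x = w} {y = w′} e rest) (w∉ ∷ uniq) bal
  with remove-walk {f = set f w w′ false}
                   (walk-mapᵛ (λ x∈ _ h → trans (set-off f false (inj₁ (≢-sym (All.lookup w∉ x∈)))) h) rest)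
                   uniq (remove-arc-shifts-source e bal)
... | f′ , f′⊆ , bal′ , removed =
  f′ , (λ x y → set-false-⊆ {f = f} w w′ x y ∘ f′⊆ x y) , bal′ , removed′
  where
  removed′ : ∀ {a b} → (a , b) ∈ arcsOf (w ∷ w′ ∷ _) → f′ a b ≡ false
  removed′ (there ab) = removed ab
  removed′ (here refl) with f′ w w′ in f′ww′
  ... | false = refl
  ... | true  = contradiction (set-at f w w′ false) (true≢false (f′⊆ w w′ f′ww′))

inside : (Fin m → Bool) → (Fin m → ℕ) → Fin m → ℕ
inside X g a = if X a then g a else 0

internal crossing : BoolRel m → (Fin m → Bool) → ℕ
internal f X = sum (λ a → count (λ b → X a ∧ (X b ∧ f a b)))
crossing f X = sum (λ a → count (λ b → X a ∧ (not (X b) ∧ f a b)))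

count-false : ∀ m → count {m} (λ _ → false) ≡ 0
count-false m = sum-zero {m} (λ _ → refl)

count-split : (P Q : Fin m → Bool) → count Q ≡ count (λ x → P x ∧ Q x) + count (λ x → not (P x) ∧ Q x)
count-split P Q = trans (sum-cong-≗ bit-split) (∑-distrib-+ (λ x → bit (P x ∧ Q x)) (λ x → bit (not (P x) ∧ Q x)))
  where
  bit-split : ∀ x → bit (Q x) ≡ bit (P x ∧ Q x) + bit (not (P x) ∧ Q x)
  bit-split x with P x
  ... | true  = sym (+-identityʳ _)
  ... | false = refl

sum-inside-out : (f : BoolRel m) (X : Fin m → Bool) → sum (inside X (out f)) ≡ internal f X + crossing f X
sum-inside-out {m} f X =
  trans (sum-cong-≗ split) (∑-distrib-+ (λ a → count (λ b → X a ∧ (X b ∧ f a b)))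
                                       (λ a → count (λ b → X a ∧ (not (X b) ∧ f a b))))
  where
  split : ∀ a → inside X (out f) a ≡ count (λ b → X a ∧ (X b ∧ f a b)) + count (λ b → X a ∧ (not (X b) ∧ f a b))
  split a with X a
  ... | true  = count-split X (f a)
  ... | false = cong₂ _+_ (sym (count-false m)) (sym (count-false m))

internal-flip : (f : BoolRel m) (X : Fin m → Bool) → internal (flip f) X ≡ internal f X
internal-flip f X = trans (∑-comm (λ a b → bit (X a ∧ (X b ∧ f b a))))
                          (sum-cong-≗ λ b → sum-cong-≗ λ a → cong bit (swap a b))
  where
  swap : ∀ a b → X a ∧ (X b ∧ f b a) ≡ X b ∧ (X a ∧ f b a)
  swap a b with X a | X b
  ... | true  | _     = refl
  ... | false | true  = refl
  ... | false | false = refl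

sum-inside-+ : (X : Fin m → Bool) (g h : Fin m → ℕ) → sum (inside X (g +ᶠ h)) ≡ sum (inside X g) + sum (inside X h)
sum-inside-+ X g h = trans (sum-cong-≗ distrib) (∑-distrib-+ (inside X g) (inside X h))
  where
  distrib : ∀ a → inside X (g +ᶠ h) a ≡ inside X g a + inside X h a
  distrib a with X a
  ... | true  = refl
  ... | false = refl

sum-inside-δ : (X : Fin m → Bool) (a : Fin m) (K : ℕ) → sum (inside X (δ a K)) ≡ inside X (δ a K) a
sum-inside-δ X a K = sum-point a off
  where
  off : ∀ x → x ≢ a → inside X (δ a K) x ≡ 0
  off x x≢a with X x
  ... | true  = δ-off x≢a
  ... | false = refl

-- Summing the balance equations over X: every arc inside X cancels.
crossing-balance : ∀ {X} → Balanced f (δ t K) (δ s K) → X s ≡ true → X t ≡ false →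
                   crossing f X ≡ crossing (flip f) X + K
crossing-balance {f = f} {t} {K} {s} {X} bal Xs Xt = +-cancelˡ-≡ (internal f X) _ _ (begin
  internal f X + crossing f X                             ≡⟨ sum-inside-out f X ⟨
  sum (inside X (out f))                                  ≡⟨ +-identityʳ _ ⟨
  sum (inside X (out f)) + 0                              ≡⟨ cong (_ +_) inside-δt ⟨
  sum (inside X (out f)) + sum (inside X (δ t K))         ≡⟨ sum-inside-+ X (out f) (δ t K) ⟨
  sum (inside X (out f +ᶠ δ t K))                         ≡⟨ sum-cong-≗ balance-inside ⟩
  sum (inside X (inn f +ᶠ δ s K))                         ≡⟨ sum-inside-+ X (inn f) (δ s K) ⟩
  sum (inside X (inn f)) + sum (inside X (δ s K))         ≡⟨ cong₂ _+_ (sum-inside-out (flip f) X) inside-δs ⟩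
  internal (flip f) X + crossing (flip f) X + K           ≡⟨ cong (λ i → i + crossing (flip f) X + K) (internal-flip f X) ⟩
  internal f X + crossing (flip f) X + K                  ≡⟨ +-assoc (internal f X) _ _ ⟩
  internal f X + (crossing (flip f) X + K)                ∎)
  where
  open ≡-Reasoning
  balance-inside : ∀ a → inside X (out f +ᶠ δ t K) a ≡ inside X (inn f +ᶠ δ s K) a
  balance-inside a = cong (λ n → if X a then n else 0) (bal a)
  inside-δt : sum (inside X (δ t K)) ≡ 0
  inside-δt rewrite sum-inside-δ X t K | Xt = refl
  inside-δs : sum (inside X (δ s K)) ≡ K
  inside-δs rewrite sum-inside-δ X s K | Xs = δ-at s K

crossing-zero : ∀ {X} → (∀ {a b} → X a ≡ true → X b ≡ false → f a b ≡ false) → crossing f X ≡ 0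
crossing-zero {f = f} {X} none = sum-zero λ a → sum-zero λ b → cong bit (no-arc a b)
  where
  no-arc : ∀ a b → X a ∧ (not (X b) ∧ f a b) ≡ false
  no-arc a b with X a in Xa | X b in Xb
  ... | false | _     = refl
  ... | true  | true  = refl
  ... | true  | false = none Xa Xb

members : (Fin m → Bool) → List (Fin m)
members {zero} P = []
members {suc m} P with P zero
... | true  = zero ∷ map suc (members (P ∘ suc))
... | false = map suc (members (P ∘ suc))

length-members : (P : Fin m → Bool) → length (members P) ≡ count P
length-members {zero} P = refl
length-members {suc m} P with P zero
... | true  = cong suc (trans (length-map suc (members (P ∘ suc))) (length-members (P ∘ suc)))
... | false = trans (length-map suc (members (P ∘ suc))) (length-members (P ∘ suc))

∈-members : (P : Fin m → Bool) → P x ≡ true → x ∈ members P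
∈-members {suc m} {zero} P Px with P zero
∈-members {suc m} {zero} P refl | true = here refl
∈-members {suc m} {suc x} P Px with P zero
... | true  = there (∈-map⁺ suc (∈-members (P ∘ suc) Px))
... | false = ∈-map⁺ suc (∈-members (P ∘ suc) Px)

arcs : ∀ {k l} → (Fin k → Fin l → Bool) → List (Fin k × Fin l)
arcs {zero} F = []
arcs {suc k} F = map (zero ,_) (members (F zero)) ++ map (map₁ suc) (arcs (F ∘ suc))

length-arcs : ∀ {k l} (F : Fin k → Fin l → Bool) → length (arcs F) ≡ sum (λ a → count (F a))
length-arcs {zero} F = refl
length-arcs {suc k} F = begin
  length (map (zero ,_) (members (F zero)) ++ map (map₁ suc) (arcs (F ∘ suc)))
    ≡⟨ length-++ (map (zero ,_) (members (F zero))) ⟩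
  length (map (zero ,_) (members (F zero))) + length (map (map₁ suc) (arcs (F ∘ suc)))
    ≡⟨ cong₂ _+_ (length-map (zero ,_) (members (F zero))) (length-map (map₁ suc) (arcs (F ∘ suc))) ⟩
  length (members (F zero)) + length (arcs (F ∘ suc))
    ≡⟨ cong₂ _+_ (length-members (F zero)) (length-arcs (F ∘ suc)) ⟩
  count (F zero) + sum (λ a → count (F (suc a)))
    ∎
  where open ≡-Reasoning

∈-arcs : ∀ {k l} (F : Fin k → Fin l → Bool) {a b} → F a b ≡ true → (a , b) ∈ arcs F
∈-arcs {suc k} F {zero} Fab = ∈-++⁺ˡ (∈-map⁺ (zero ,_) (∈-members (F zero) Fab))
∈-arcs {suc k} F {suc a} Fab =
  ∈-++⁺ʳ (map (zero ,_) (members (F zero))) (∈-map⁺ (map₁ suc) (∈-arcs (F ∘ suc) Fab))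

DisjointPaths : BoolRel m → Fin m → Fin m → ℕ → Set
DisjointPaths {m} A s t K =
  Σ (Fin K → List (Fin m)) λ ps → (∀ i → IsWalk A s t (ps i) × Unique (ps i)) ×
                                  (∀ i j → i ≢ j → ArcDisjoint (ps i) (ps j))

disjointPaths-mono : B ⊆ᴬ A → DisjointPaths B s t K → DisjointPaths A s t K
disjointPaths-mono B⊆A (ps , paths , disjoint) =
  ps , (λ i → walk-map (B⊆A _ _) (proj₁ (paths i)) , proj₂ (paths i)) , disjoint

disjointPaths-cons : ∀ {p} → B ⊆ᴬ A → IsWalk A s t p → Unique p →
                     (∀ {a b} → (a , b) ∈ arcsOf p → B a b ≡ false) →
                     DisjointPaths B s t K → DisjointPaths A s t (suc K)
disjointPaths-cons {p = p} B⊆A walk uniq outside (ps , paths , disjoint) = ps′ , paths′ , disjoint′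
  where
  ps′ : Fin (suc _) → List _
  ps′ zero    = p
  ps′ (suc i) = ps i
  paths′ : ∀ i → IsWalk _ _ _ (ps′ i) × Unique (ps′ i)
  paths′ zero    = walk , uniq
  paths′ (suc i) = walk-map (B⊆A _ _) (proj₁ (paths i)) , proj₂ (paths i)
  clash : ∀ i {a b} → (a , b) ∈ arcsOf p → (a , b) ∈ arcsOf (ps i) → ⊥
  clash i ab∈p ab∈ = true≢false (walk-arc (proj₁ (paths i)) ab∈) (outside ab∈p)
  disjoint′ : ∀ i j → i ≢ j → ArcDisjoint (ps′ i) (ps′ j)
  disjoint′ zero    zero    i≢j = contradiction refl i≢j
  disjoint′ zero    (suc j) _ _ ab∈p ab∈ = clash j ab∈p ab∈
  disjoint′ (suc i) zero    _ _ ab∈ ab∈p = clash i ab∈p ab∈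
  disjoint′ (suc i) (suc j) i≢j = disjoint i j (i≢j ∘ cong suc)

record SmallCut (A : BoolRel m) (s t : Fin m) (K : ℕ) : Set where
  field
    X       : Fin m → Bool
    s∈X     : X s ≡ true
    t∉X     : X t ≡ false
    cutArcs : List (Fin m × Fin m)
    small   : length cutArcs < K
    covers  : ∀ {a b} → A a b ≡ true → X a ≡ true → X b ≡ false → (a , b) ∈ cutArcs

Flow : BoolRel m → Fin m → Fin m → ℕ → Set
Flow A s t K = ∃ λ f → f ⊆ᴬ A × Balanced f (δ t K) (δ s K)

δ-zero : (a : Fin m) → ∀ x → δ a 0 x ≡ 0
δ-zero a x with x ≟ a
... | yes _ = refl
... | no _  = refl

balanced-+ : {g : Fin m → ℕ} → Balanced f sink source → Balanced f (sink +ᶠ g) (source +ᶠ g)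
balanced-+ {f = f} {sink} {source} {g} bal x = begin
  out f x + (sink x + g x)    ≡⟨ +-assoc (out f x) _ _ ⟨
  out f x + sink x + g x      ≡⟨ cong (_+ g x) (bal x) ⟩
  inn f x + source x + g x    ≡⟨ +-assoc (inn f x) _ _ ⟩
  inn f x + (source x + g x)  ∎
  where open ≡-Reasoning

zero-flow : Flow A s t 0
zero-flow {m} {s = s} {t} = (λ _ _ → false) , (λ _ _ ()) , balanced
  where
  balanced : Balanced (λ _ _ → false) (δ t 0) (δ s 0)
  balanced x rewrite count-false m | δ-zero t x | δ-zero s x = refl

augment-flow : f ⊆ᴬ A → Balanced f (δ t K) (δ s K) →
               IsWalk (residual A f) s t vs → Unique vs → Flow A s t (suc K)
augment-flow {t = t} {K} {s} f⊆A bal path uniq =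
  let f′ , f′⊆A , bal′ = augment path uniq f⊆A (balanced-+ {g = δ s 1} bal)
  in f′ , f′⊆A , balanced-cong (δ-+1 t K) (δ-+1 s K) bal′

residual-forward : A a b ≡ true → f a b ≡ false → residual A f a b ≡ true
residual-forward ab fab rewrite ab | fab = refl

residual-backward : ∀ {A f : BoolRel m} {a b} → f b a ≡ true → residual A f a b ≡ true
residual-backward {A = A} {f} {a} {b} fba rewrite fba = Bool.∨-zeroʳ (A a b ∧ not (f a b))

residual-cut : ∀ {R} → f ⊆ᴬ A → Balanced f (δ t K) (δ s K) → Closed (residual A f) R →
               R s ≡ true → R t ≡ false → SmallCut A s t (suc K)
residual-cut {f = f} {A} {t} {K} {s} {R} f⊆A bal closed Rs Rt = record
  { X = R ; s∈X = Rs ; t∉X = Rt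
  ; cutArcs = arcs leaving
  ; small = ≤-reflexive (cong suc length≡K)
  ; covers = λ ab Ra Rb → ∈-arcs leaving (leaving-arc Ra Rb (in-flow ab Ra Rb)) }
  where
  leaving : BoolRel _
  leaving a b = R a ∧ (not (R b) ∧ f a b)
  leaving-arc : ∀ {a b} → R a ≡ true → R b ≡ false → f a b ≡ true → leaving a b ≡ true
  leaving-arc Ra Rb fab rewrite Ra | Rb | fab = refl
  in-flow : ∀ {a b} → A a b ≡ true → R a ≡ true → R b ≡ false → f a b ≡ true
  in-flow {a} {b} ab Ra Rb with f a b in fab
  ... | true  = refl
  ... | false = contradiction Rb (true≢false (closed Ra (residual-forward {A = A} {f = f} ab fab)))
  none-enter : ∀ {a b} → R a ≡ true → R b ≡ false → f b a ≡ false
  none-enter {a} {b} Ra Rb with f b a in fba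
  ... | false = refl
  ... | true  = contradiction Rb (true≢false (closed Ra (residual-backward {A = A} {f = f} {a = a} fba)))
  length≡K : length (arcs leaving) ≡ K
  length≡K = trans (length-arcs leaving) (trans (crossing-balance bal Rs Rt)
                    (cong (_+ K) (crossing-zero {f = flip f} none-enter)))

smallCut-suc : SmallCut A s t K → SmallCut A s t (suc K)
smallCut-suc cut = record { SmallCut cut ; small = m≤n⇒m≤1+n (SmallCut.small cut) }

-- Augmenting paths: either t is reachable in the residual graph of a K-flow, which then grows to
-- a (K+1)-flow, or the reachable set is a cut whose leaving arcs are exactly the K flow arcs.
flow-or-cut : (A : BoolRel m) (s t : Fin m) (K : ℕ) → Flow A s t K ⊎ SmallCut A s t K
flow-or-cut A s t zero = inj₁ zero-flow
flow-or-cut A s t (suc K) with flow-or-cut A s t K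
... | inj₂ cut = inj₂ (smallCut-suc cut)
... | inj₁ (f , f⊆A , bal) with reach (residual A f) s
...   | r with Reach.R r t in Rt
...     | true  = let _ , walk = Reach.walk-to r Rt ; _ , path , uniq = walk⇒path walk
                  in inj₁ (augment-flow f⊆A bal path uniq)
...     | false = inj₂ (residual-cut f⊆A bal (Reach.closed r) (Reach.s∈R r) Rt)

flow⇒paths : ∀ K → Balanced f (δ t K) (δ s K) → DisjointPaths f s t K
flow⇒paths zero _ = (λ ()) , (λ ()) , λ ()
flow⇒paths {f = f} {t} {s} (suc K) bal with reach f s
... | r with Reach.R r t in Rt
... | false = contradiction (trans (sym (crossing-zero {f = f} none-leave)) (crossing-balance bal (Reach.s∈R r) Rt))
                            (λ 0≡ → 1+n≢0 (trans (sym (+-suc _ K)) (sym 0≡)))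
  where
  none-leave : ∀ {a b} → Reach.R r a ≡ true → Reach.R r b ≡ false → f a b ≡ false
  none-leave {a} {b} Ra Rb with f a b in fab
  ... | false = refl
  ... | true  = contradiction Rb (true≢false (Reach.closed r Ra fab))
... | true with walk⇒path (proj₂ (Reach.walk-to r Rt))
...   | p , path , uniq with remove-walk path uniq (balanced-cong (sym ∘ δ-+1 t K) (sym ∘ δ-+1 s K) bal)
...     | f′ , f′⊆f , bal′ , removed =
          disjointPaths-cons f′⊆f path uniq removed (flow⇒paths K (balanced-cancel bal′))

menger : (A : BoolRel m) (s t : Fin m) (K : ℕ) → DisjointPaths A s t K ⊎ SmallCut A s t K
menger A s t K with flow-or-cut A s t K
... | inj₁ (f , f⊆A , bal) = inj₁ (disjointPaths-mono f⊆A (flow⇒paths K bal))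
... | inj₂ cut = inj₂ cut

-- Gluing colourings along small cuts

short-list-misses : (L : List (Fin k)) → length L < k → ∃ λ t → t ∉ L
short-list-misses {k} L L<k with any? (λ t → ¬? (Any.any? (t ≟_) L))
... | yes found = found
... | no none = contradiction (pigeonhole L<k (index ∘ member)) collision
  where
  member : ∀ t → t ∈ L
  member t with Any.any? (t ≟_) L
  ... | yes t∈ = t∈
  ... | no t∉  = contradiction (t , t∉) none
  collision : ¬ ∃₂ λ i j → _<ᶠ_ i j × index (member i) ≡ index (member j)
  collision (i , j , i<j , same) =
    <ᶠ⇒≢ i<j (trans (lookup-index (member i)) (trans (cong (lookup L) same) (sym (lookup-index (member j)))))

module Rotation (k : ℕ) .{{_ : NonZero k}} where

  rotate : Fin k → Fin k → Fin k
  rotate t β = fromℕ< (m%n<n (toℕ β + toℕ t) k)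

  offset : Fin k → Fin k → Fin k
  offset α β = fromℕ< (m%n<n (toℕ α + (k ∸ toℕ β)) k)

  cancel-addˡ : ∀ b a → b < k → a < k → ((b + a) % k + (k ∸ b)) % k ≡ a
  cancel-addˡ b a b<k a<k = begin
    ((b + a) % k + (k ∸ b)) % k          ≡⟨ %-distribˡ-+ ((b + a) % k) (k ∸ b) k ⟩
    ((b + a) % k % k + (k ∸ b) % k) % k  ≡⟨ cong (λ r → (r + (k ∸ b) % k) % k) (m%n%n≡m%n (b + a) k) ⟩
    ((b + a) % k + (k ∸ b) % k) % k      ≡⟨ %-distribˡ-+ (b + a) (k ∸ b) k ⟨
    (b + a + (k ∸ b)) % k                ≡⟨ cong (_% k) b+a+[k∸b] ⟩
    (a + k) % k                          ≡⟨ [m+n]%n≡m%n a k ⟩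
    a % k                                ≡⟨ m<n⇒m%n≡m a<k ⟩
    a                                    ∎
    where
    open ≡-Reasoning
    b+a+[k∸b] : b + a + (k ∸ b) ≡ a + k
    b+a+[k∸b] = trans (cong (_+ (k ∸ b)) (+-comm b a))
                      (trans (+-assoc a b (k ∸ b)) (cong (a +_) (m+[n∸m]≡n (<⇒≤ b<k))))

  cancel-addʳ : ∀ b a → b < k → a < k → ((a + b) % k + (k ∸ b)) % k ≡ a
  cancel-addʳ b a b<k a<k = trans (cong (λ r → (r % k + (k ∸ b)) % k) (+-comm a b)) (cancel-addˡ b a b<k a<k)

  toℕ-rotate : ∀ t β → toℕ (rotate t β) ≡ (toℕ β + toℕ t) % k
  toℕ-rotate t β = toℕ-fromℕ< (m%n<n (toℕ β + toℕ t) k)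

  rotate-injective : ∀ t {β β′} → rotate t β ≡ rotate t β′ → β ≡ β′
  rotate-injective t {β} {β′} same = toℕ-injective (begin
    toℕ β                                       ≡⟨ cancel-addʳ (toℕ t) (toℕ β) (toℕ<n t) (toℕ<n β) ⟨
    ((toℕ β + toℕ t) % k + (k ∸ toℕ t)) % k     ≡⟨ cong (λ r → (r + (k ∸ toℕ t)) % k) mod-same ⟩
    ((toℕ β′ + toℕ t) % k + (k ∸ toℕ t)) % k    ≡⟨ cancel-addʳ (toℕ t) (toℕ β′) (toℕ<n t) (toℕ<n β′) ⟩
    toℕ β′                                      ∎)
    where
    open ≡-Reasoning
    mod-same : (toℕ β + toℕ t) % k ≡ (toℕ β′ + toℕ t) % k
    mod-same = trans (sym (toℕ-rotate t β)) (trans (cong toℕ same) (toℕ-rotate t β′))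

  offset-rotate : ∀ t β {α} → rotate t β ≡ α → offset α β ≡ t
  offset-rotate t β refl = toℕ-injective (begin
    toℕ (offset (rotate t β) β)                ≡⟨ toℕ-fromℕ< (m%n<n _ k) ⟩
    (toℕ (rotate t β) + (k ∸ toℕ β)) % k       ≡⟨ cong (λ r → (r + (k ∸ toℕ β)) % k) (toℕ-rotate t β) ⟩
    ((toℕ β + toℕ t) % k + (k ∸ toℕ β)) % k    ≡⟨ cancel-addˡ (toℕ β) (toℕ t) (toℕ<n β) (toℕ<n t) ⟩
    toℕ t                                      ∎)
    where open ≡-Reasoning

  -- Each pair (α , β) forbids exactly one rotation, namely offset α β.
  avoiding-rotation : (L : List (Fin k × Fin k)) → length L < k →
                      ∃ λ t → ∀ {α β} → (α , β) ∈ L → rotate t β ≢ α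
  avoiding-rotation L L<k =
    let t , t∉ = short-list-misses (map offset′ L) (subst (_< k) (sym (length-map offset′ L)) L<k)
    in t , λ {α} {β} αβ∈ rot →
         t∉ (subst (_∈ map offset′ L) (offset-rotate t β rot) (∈-map⁺ offset′ αβ∈))
    where
    offset′ : Fin k × Fin k → Fin k
    offset′ (α , β) = offset α β

Dicolours : BoolRel m → (Fin m → Fin k) → Set
Dicolours A c = ∀ vs → Cycle A vs → ¬ Monochromatic c vs

all-constant : ∀ {X : Fin m → Bool} p → ¬ Any (λ z → X z ≡ not p) vs → All (λ z → X z ≡ p) vs
all-constant {vs = vs} p none = All.map (λ ¬q → trans (Bool.¬-not ¬q) (Bool.not-involutive p)) (All.¬Any⇒All¬ vs none)

module _ (X : Fin m → Bool) (c₁ c₂ : Fin m → Fin k) (σ : Fin k → Fin k) where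

  glued : Fin m → Fin k
  glued z = if X z then c₁ z else σ (c₂ z)

  glued-in : X z ≡ true → glued z ≡ c₁ z
  glued-in Xz rewrite Xz = refl

  glued-out : X z ≡ false → glued z ≡ σ (c₂ z)
  glued-out Xz rewrite Xz = refl

  glue : Injective _≡_ _≡_ σ →
         (∀ vs → Cycle A vs → All (λ z → X z ≡ true) vs → ¬ Monochromatic c₁ vs) →
         (∀ vs → Cycle A vs → All (λ z → X z ≡ false) vs → ¬ Monochromatic c₂ vs) →
         (∀ {a b} → A a b ≡ true → X a ≡ true → X b ≡ false → c₁ a ≢ σ (c₂ b)) →
         Dicolours A glued
  glue {A = A} σ-inj inside outside crossing vs cyc@(x , y , w , yx , _) (col , mono)
    with Any.any? (λ z → X z Bool.≟ false) vs | Any.any? (λ z → X z Bool.≟ true) vs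
  ... | no none-out | _ = inside vs cyc all-in (col , All.zipWith in-col (all-in , mono))
    where
    all-in : All (λ z → X z ≡ true) vs
    all-in = all-constant true none-out
    in-col : ∀ {z} → X z ≡ true × glued z ≡ col → c₁ z ≡ col
    in-col (Xz , gz) = trans (sym (glued-in Xz)) gz
  ... | yes _ | no none-in = outside vs cyc all-out (c₂ x , All.zipWith out-col (all-out , mono))
    where
    all-out : All (λ z → X z ≡ false) vs
    all-out = all-constant false none-in
    σc₂≡col : ∀ {z} → X z ≡ false → glued z ≡ col → σ (c₂ z) ≡ col
    σc₂≡col Xz gz = trans (sym (glued-out Xz)) gz
    out-col : ∀ {z} → X z ≡ false × glued z ≡ col → c₂ z ≡ c₂ x
    out-col (Xz , gz) = σ-inj (trans (σc₂≡col Xz gz)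
                                     (sym (σc₂≡col (All.lookup all-out (walk-head w)) (All.lookup mono (walk-head w)))))
  ... | yes out | yes in′ = cross exit
    where
    exit : ExitArc A X vs
    exit with find out | find in′ | X x in Xx
    ... | z , z∈ , Xz | _ | true  = walk-exit-before X w Xx z∈ Xz
    ... | _ | z , z∈ , Xz | false = exit-⊆ back (walk-exit-after X (walk-snoc w yx) Xx (∈-++⁺ˡ z∈) Xz)
      where
      back : vs ++ [ x ] ⊆ vs
      back z∈ with ∈-++⁻ vs z∈
      ... | inj₁ z∈vs = z∈vs
      ... | inj₂ (here refl) = walk-head w
    cross : ExitArc A X vs → ⊥
    cross (p , q , pq , Xp , Xq , p∈ , q∈) =
      crossing pq Xp Xq (trans (trans (sym (glued-in Xp)) (All.lookup mono p∈))
                               (sym (trans (sym (glued-out Xq)) (All.lookup mono q∈))))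

glue-along-cut : .{{_ : NonZero k}} (X : Fin m → Bool) (c₁ c₂ : Fin m → Fin k) (pairs : List (Fin k × Fin k)) →
                 length pairs < k →
                 (∀ {a b} → A a b ≡ true → X a ≡ true → X b ≡ false → (c₁ a , c₂ b) ∈ pairs) →
                 (∀ vs → Cycle A vs → All (λ z → X z ≡ true) vs → ¬ Monochromatic c₁ vs) →
                 (∀ vs → Cycle A vs → All (λ z → X z ≡ false) vs → ¬ Monochromatic c₂ vs) →
                 ∃ λ c → Dicolours A c
glue-along-cut {k} X c₁ c₂ pairs small covers inside outside =
  let t , avoids = avoiding-rotation pairs small
  in glued X c₁ c₂ (rotate t) ,
     glue X c₁ c₂ (rotate t) (rotate-injective t) inside outside
          (λ ab Xa Xb c₁a≡ → avoids (covers ab Xa Xb) (sym c₁a≡))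
  where open Rotation k

induced : BoolRel m → (Fin m → Bool) → BoolRel m
induced A S a b = A a b ∧ (S a ∧ S b)

induced-ends : ∀ {S : Fin m → Bool} → induced A S a b ≡ true → S a ≡ true × S b ≡ true
induced-ends {A = A} {a = a} {b = b} {S = S} h with A a b | S a | S b
... | true | true | true = refl , refl

induced-⊆ : ∀ {S : Fin m → Bool} → induced A S a b ≡ true → A a b ≡ true
induced-⊆ {A = A} {a = a} {b = b} h with A a b
... | true = refl

_∩_ _∖_ : (Fin m → Bool) → (Fin m → Bool) → Fin m → Bool
(S ∩ X) z = S z ∧ X z
(S ∖ X) z = S z ∧ not (X z)

induced-∩ : ∀ {S X : Fin m → Bool} → induced A S a b ≡ true → X a ≡ true → X b ≡ true →
            induced A (S ∩ X) a b ≡ true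
induced-∩ {A = A} {a = a} {b = b} {S = S} h Xa Xb rewrite Xa | Xb with A a b | S a | S b
... | true | true | true = refl

combine-across-cut : ∀ {S} (cut : SmallCut (induced A S) x y (suc k)) {c₁ c₂ : Fin m → Fin (suc k)} →
                     Dicolours (induced A (S ∩ SmallCut.X cut)) c₁ →
                     Dicolours (induced A (S ∖ SmallCut.X cut)) c₂ →
                     ∃ λ c → Dicolours (induced A S) c
combine-across-cut {A = A} {k = k} {S = S} cut {c₁} {c₂} dicolours₁ dicolours₂ =
  glue-along-cut X c₁ c₂ (map colour-pair cutArcs) (subst (_< suc k) (sym (length-map colour-pair cutArcs)) small)
    (λ ab Xa Xb → ∈-map⁺ colour-pair (covers ab Xa Xb))
    (λ vs cyc all-in → dicolours₁ vs (cycle-map (λ a∈ b∈ ab →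
       induced-∩ {A = A} {S = S} ab (All.lookup all-in a∈) (All.lookup all-in b∈)) cyc))
    (λ vs cyc all-out → dicolours₂ vs (cycle-map (λ a∈ b∈ ab →
       induced-∩ {A = A} {S = S} ab (cong not (All.lookup all-out a∈)) (cong not (All.lookup all-out b∈))) cyc))
  where
  open SmallCut cut
  colour-pair : Fin _ × Fin _ → Fin (suc k) × Fin (suc k)
  colour-pair (a , b) = c₁ a , c₂ b

-- Induction on |S|: split S along a cut of at most k arcs of D[S] and colour both sides.
dicolouring-from-sparse-pairs :
  (A : BoolRel m) →
  (∀ S {x₀ y₀} → S x₀ ≡ true → S y₀ ≡ true → x₀ ≢ y₀ →
     ∃₂ λ x y → S x ≡ true × S y ≡ true × ¬ DisjointPaths (induced A S) x y (suc k)) →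
  ∃ λ (c : Fin m → Fin (suc k)) → Dicolours A c
dicolouring-from-sparse-pairs {m} {k} A sparse =
  let c , dicolours = colour (suc m) (λ _ → true) (s≤s (count≤ _))
  in c , λ vs cyc → dicolours vs (cycle-map (λ _ _ ab → trans (Bool.∧-identityʳ _) ab) cyc)
  where
  colour : ∀ fuel S → count S < fuel → ∃ λ (c : Fin m → Fin (suc k)) → Dicolours (induced A S) c
  colour (suc fuel) S count<fuel
    with any? (λ x → any? (λ y → ¬? (x ≟ y) ×-dec (S x Bool.≟ true) ×-dec (S y Bool.≟ true)))
  ... | no no-pair = (λ _ → zero) , lone
    where
    lone : Dicolours (induced A S) (λ _ → zero)
    lone (a ∷ b ∷ _) (_ , _ , cons ab _ , _ , (a∉ ∷ _) , _) _ =
      let Sa , Sb = induced-ends {A = A} ab in no-pair (a , b , All.head a∉ , Sa , Sb)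
    lone (_ ∷ []) (_ , _ , _ , _ , _ , s≤s ()) _
  ... | yes (x₀ , y₀ , x₀≢y₀ , Sx₀ , Sy₀) with sparse S Sx₀ Sy₀ x₀≢y₀
  ... | x , y , Sx , Sy , few-paths with menger (induced A S) x y (suc k)
  ... | inj₁ paths = contradiction paths few-paths
  ... | inj₂ cut = combine-across-cut {A = A} {S = S} cut (proj₂ (colour fuel (S ∩ X) (shrinks t∉X Sy)))
                                                         (proj₂ (colour fuel (S ∖ X) (shrinks (cong not s∈X) Sx)))
    where
    open SmallCut cut using (X; s∈X; t∉X)
    shrinks : ∀ {P z} → P z ≡ false → S z ≡ true → count (S ∩ P) < fuel
    shrinks {P} {z} Pz Sz = <-≤-trans (count-⊂ {z = z} {P = S ∩ P} {Q = S} ∧-trueˡ S∩Pz Sz) (≤-pred count<fuel)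
      where
      S∩Pz : (S ∩ P) z ≡ false
      S∩Pz rewrite Pz = Bool.∧-zeroʳ (S z)

-- Ears

module _ (D : Digraph) (S : Vertex D → Bool) where

  private variable
    p q : Vertex D

  outerArc outsideArc : BoolRel (n D)
  outerArc a b = arc D a b ∧ (not (S a) ∨ not (S b))
  outsideArc a b = arc D a b ∧ (not (S a) ∧ not (S b))

  outer-from : arc D a b ≡ true → S a ≡ false → outerArc a b ≡ true
  outer-from ab Sa rewrite ab | Sa = refl

  outer-to : arc D a b ≡ true → S b ≡ false → outerArc a b ≡ true
  outer-to {a} ab Sb rewrite ab | Sb = Bool.∨-zeroʳ (not (S a))

  outer⊆arc : outerArc a b ≡ true → arc D a b ≡ true
  outer⊆arc {a} {b} = ∧-trueˡ {q = not (S a) ∨ not (S b)}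

  outside : arc D a b ≡ true → S a ≡ false → S b ≡ false → outsideArc a b ≡ true
  outside ab Sa Sb rewrite ab | Sa | Sb = refl

  outside-ends : outsideArc a b ≡ true → arc D a b ≡ true × S a ≡ false × S b ≡ false
  outside-ends {a} {b} h with arc D a b | S a | S b
  ... | true | false | false = refl , refl , refl

  outside⊆outer : outsideArc a b ≡ true → outerArc a b ≡ true
  outside⊆outer h = let ab , Sa , _ = outside-ends h in outer-from ab Sa

  first-entry : IsWalk (arc D) p z vs → S p ≡ false → S z ≡ true →
                ∃₂ λ a b → (∃ λ us → IsWalk outsideArc p a us) × arc D a b ≡ true × S a ≡ false × S b ≡ true
  first-entry (single _) Sp Sz = contradiction Sp (true≢false Sz)
  first-entry (cons {y = p′} e w) Sp Sz with S p′ in Sp′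
  ... | true  = _ , _ , (_ , single _) , e , Sp , Sp′
  ... | false = let a , b , (_ , pa) , ab , Sa , Sb = first-entry w Sp′ Sz
                in a , b , (_ , walk-cons (outside e Sp Sp′) pa) , ab , Sa , Sb

  LastExit : Vertex D → Set
  LastExit q = ∃₂ λ w a → S w ≡ true × arc D w a ≡ true × S a ≡ false × ∃ λ us → IsWalk outsideArc a q us

  last-exit : IsWalk (arc D) z q vs → S q ≡ false →
              (S z ≡ false × ∃ λ us → IsWalk outsideArc z q us) ⊎ LastExit q
  last-exit (single _) Sq = inj₁ (Sq , _ , single _)
  last-exit (cons {x = z} {y = z′} e w) Sq with last-exit w Sq
  ... | inj₂ exit = inj₂ exit
  ... | inj₁ (Sz′ , _ , z′q) with S z in Sz
  ...   | false = inj₁ (refl , _ , walk-cons (outside e Sz Sz′) z′q)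
  ...   | true  = inj₂ (z , z′ , Sz , e , Sz′ , _ , z′q)

  Ear : Set
  Ear = ∃₂ λ x y → S x ≡ true × S y ≡ true × x ≢ y × ∃ λ vs → IsWalk outerArc x y vs

  outer-not-induced : ∀ {B : BoolRel (n D)} → outerArc a b ≡ true → induced B S a b ≡ false
  outer-not-induced {a = a} {b} {B} h with S a | S b
  ... | false | _     = Bool.∧-zeroʳ (B a b)
  ... | true  | false = Bool.∧-zeroʳ (B a b)
  ... | true  | true  = contradiction (Bool.∧-zeroʳ (arc D a b)) (true≢false h)

  escape : Vertex D → BoolRel (n D)
  escape x a b = arc D a b ∧ (not (S b) ∧ (⌊ a ≟ x ⌋ ∨ not (S a)))

  escape-ends : escape x a b ≡ true → arc D a b ≡ true × S b ≡ false
  escape-ends {a = a} {b} h with arc D a b | S b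
  ... | true | false = refl , refl

  outside⊆escape : outsideArc a b ≡ true → escape x a b ≡ true
  outside⊆escape {a} {b} {x} h with outside-ends h
  ... | ab , Sa , Sb rewrite ab | Sa | Sb = Bool.∨-zeroʳ ⌊ a ≟ x ⌋

  escape-start : arc D x b ≡ true → S b ≡ false → escape x x b ≡ true
  escape-start {x} xb Sb rewrite xb | Sb with x ≟ x
  ... | yes _  = refl
  ... | no x≢x = contradiction refl x≢x

  module _ (strong : Strong D) (biconnected : Biconnected D) where

    -- R is the set of vertices reached from x by leaving S at once and then staying outside S.
    module Escape {x} (Sx : S x ≡ true) where
      r : Reach (escape x) x
      r = reach (escape x) x
      open Reach r using (R; walk-to; closed)

      Rᵒ : Vertex D → Bool
      Rᵒ z = R z ∧ not (S z)

      Rᵒ-in : ∀ {z} → R z ≡ true → S z ≡ false → Rᵒ z ≡ true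
      Rᵒ-in Rz Sz rewrite Rz | Sz = refl

      Rᵒ-out : ∀ {z} → S z ≡ true → Rᵒ z ≡ false
      Rᵒ-out {z} Sz rewrite Sz = Bool.∧-zeroʳ (R z)

      Rᵒ-split : ∀ {z} → Rᵒ z ≡ true → R z ≡ true × S z ≡ false
      Rᵒ-split {z} h with R z | S z
      ... | true | false = refl , refl

      R-outer : ∀ {z} → R z ≡ true → ∃ λ us → IsWalk outerArc x z us
      R-outer Rz = let _ , xz = walk-to Rz in _ , walk-map (λ h → let ab , Sb = escape-ends h in outer-to ab Sb) xz

      ear-through : ∀ {a c} → R a ≡ true → S a ≡ false → arc D a c ≡ true → S c ≡ true → c ≢ x → Ear
      ear-through Ra Sa ac Sc c≢x =
        x , _ , Sx , Sc , c≢x ∘ sym , _ , walk-snoc (proj₂ (R-outer Ra)) (outer-from ac Sa)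

      return : ∀ {p} → R p ≡ true → S p ≡ false → Ear ⊎ ∃ λ us → IsWalk outerArc p x us
      return {p} Rp Sp with first-entry (proj₁ (proj₂ (strong p x))) Sp Sx
      ... | a , c , (_ , pa) , ac , Sa , Sc with c ≟ x
      ...   | yes refl = inj₂ (_ , walk-snoc (walk-map outside⊆outer pa) (outer-from ac Sa))
      ...   | no c≢x   = inj₁ (ear-through (closed-walk closed (walk-map outside⊆escape pa) Rp) Sa ac Sc c≢x)

      ear-via-entry : ∀ {p q} → R p ≡ true → S p ≡ false → arc D q p ≡ true → Rᵒ q ≡ false → q ≢ x → Ear
      ear-via-entry {p} {q} Rp Sp qp Rᵒq q≢x with return Rp Sp | S q Bool.≟ true
      ... | inj₁ ear | _ = ear
      ... | inj₂ (_ , px) | yes Sq = q , x , Sq , Sx , q≢x , _ , walk-cons (outer-to qp Sp) px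
      ... | inj₂ (_ , px) | no ¬Sq with last-exit (proj₁ (proj₂ (strong x q))) (Bool.¬-not ¬Sq)
      ...   | inj₁ (Sx′ , _) = contradiction Sx′ (true≢false Sx)
      ...   | inj₂ (w , a , Sw , wa , Sa , _ , aq) with w ≟ x
      ...     | yes refl = contradiction Rᵒq (true≢false (Rᵒ-in Rq (Bool.¬-not ¬Sq)))
        where Rq = closed-walk closed (walk-map outside⊆escape aq) (closed (Reach.s∈R r) (escape-start wa Sa))
      ...     | no w≢x = w , x , Sw , Sx , w≢x , walk-trans (walk-cons (outer-to wa Sa) (walk-map outside⊆outer aq))
                                                          (walk-cons (outer-to qp Sp) px)

      -- Biconnectivity gives an edge leaving Rᵒ that avoids x.
      ear-from : ∀ {a₀ b} → arc D x a₀ ≡ true → S a₀ ≡ false → S b ≡ true → b ≢ x → Ear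
      ear-from {a₀} {b} xa₀ Sa₀ Sb b≢x
        with proj₂ biconnected x a₀ b (λ a₀≡x → contradiction (subst (λ z → S z ≡ false) a₀≡x Sa₀) (true≢false Sx)) b≢x
      ... | _ , a₀b , avoids-x
        with walk-exit Rᵒ a₀b (Rᵒ-in (closed (Reach.s∈R r) (escape-start xa₀ Sa₀)) Sa₀) (Rᵒ-out Sb)
      ... | p , q , pq-edge , Rᵒp , Rᵒq , _ , q∈ with Rᵒ-split Rᵒp | All.lookup avoids-x q∈
      ...   | Rp , Sp | q≢x with arc D p q in pq | S q Bool.≟ true
      ...     | true  | yes Sq = ear-through Rp Sp pq Sq q≢x
      ...     | true  | no ¬Sq =
        contradiction Rᵒq (true≢false (Rᵒ-in (closed Rp (outside⊆escape (outside pq Sp (Bool.¬-not ¬Sq)))) (Bool.¬-not ¬Sq)))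
      ...     | false | _ = ear-via-entry Rp Sp pq-edge Rᵒq q≢x

    ear : ∀ {x₀ y₀ w} → S x₀ ≡ true → S y₀ ≡ true → x₀ ≢ y₀ → S w ≡ false → Ear
    ear {x₀} {y₀} {w} Sx₀ Sy₀ x₀≢y₀ Sw with walk-exit S (proj₁ (proj₂ (strong x₀ w))) Sx₀ Sw
    ... | x , a , xa , Sx , Sa , _ with x ≟ x₀
    ...   | yes refl = Escape.ear-from Sx xa Sa Sy₀ (x₀≢y₀ ∘ sym)
    ...   | no x≢x₀  = Escape.ear-from Sx xa Sa Sx₀ (x≢x₀ ∘ sym)

-- Cycles through two given vertices

unique-++⁻ : ∀ {X : Set} (us : List X) {ws} → Unique (us ++ ws) → Unique us × Unique ws × Disjoint us ws
unique-++⁻ [] uniq = [] , uniq , λ ()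
unique-++⁻ (x ∷ us) (x∉ ∷ uniq) =
  let uus , uws , disjoint = unique-++⁻ us uniq
  in All.++⁻ˡ us x∉ ∷ uus , uws ,
     λ { (here refl , z∈ws) → All.lookup (All.++⁻ʳ us x∉) z∈ws refl
       ; (there z∈us , z∈ws) → disjoint (z∈us , z∈ws) }

unique-swap : ∀ {X : Set} (us : List X) {ws} → Unique (us ++ ws) → Unique (ws ++ us)
unique-swap us uniq =
  let uus , uws , disjoint = unique-++⁻ us uniq in Unique.++⁺ uws uus (λ (z∈ws , z∈us) → disjoint (z∈us , z∈ws))

unique-snoc : ∀ {X : Set} {us : List X} {z} → Unique us → z ∉ us → Unique (us ++ [ z ])
unique-snoc uniq z∉ = Unique.++⁺ uniq ([] ∷ []) λ { (z∈ , here refl) → z∉ z∈ }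

walk-head≡ : IsWalk A x y (a ∷ vs) → x ≡ a
walk-head≡ (single _) = refl
walk-head≡ (cons _ _) = refl

walk-rotate : ∀ us {ws} → IsWalk A x y (us ++ z ∷ ws) → A y x ≡ true → IsWalk A z z (z ∷ (ws ++ us) ++ [ z ])
walk-rotate {A = A} {z = z} [] {ws} w yx with walk-head≡ w
... | refl = subst (λ L → IsWalk A z z (z ∷ L ++ [ z ])) (sym (++-identityʳ ws)) (walk-snoc w yx)
walk-rotate {A = A} {z = z} (a ∷ us) {ws} w yx with walk-split (a ∷ us) w | walk-head≡ w
... | to-z , from-z | refl =
  subst (λ L → IsWalk A z z (z ∷ L)) (sym (++-assoc ws (a ∷ us) [ z ])) (walk-join (z ∷ ws) (walk-snoc from-z yx) to-z)

3≤length : ∀ (a b : Fin m) vs c → 3 ≤ length (a ∷ b ∷ vs ++ [ c ])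
3≤length a b [] c = s≤s (s≤s (s≤s z≤n))
3≤length a b (_ ∷ _) c = s≤s (s≤s (s≤s z≤n))

LongPath : BoolRel m → (Fin m → Set) → Fin m → Fin m → Set
LongPath A P x y = ∃ λ p → IsWalk A x y p × Unique p × 3 ≤ length p × All P p

closed-long-path : ∀ {P} M₁ M₂ → IsWalk A u u (u ∷ M₁ ++ v ∷ M₂ ++ [ u ]) → Unique (u ∷ M₁ ++ v ∷ M₂) →
                   All P (u ∷ M₁ ++ v ∷ M₂) → 2 ≤ length (M₁ ++ v ∷ M₂) →
                   LongPath A P u v ⊎ LongPath A P v u
closed-long-path {u = u} {v = v} (x ∷ M₁) M₂ w uniq all _ =
  let u→v , _ = walk-split (u ∷ x ∷ M₁) w ; uniq₁ , _ , disjoint = unique-++⁻ (u ∷ x ∷ M₁) uniq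
  in inj₁ (_ , u→v , unique-snoc uniq₁ (λ v∈ → disjoint (v∈ , here refl)) , 3≤length u x M₁ v ,
           All.++⁺ (All.++⁻ˡ (u ∷ x ∷ M₁) all) (All.head (All.++⁻ʳ (u ∷ x ∷ M₁) all) ∷ []))
closed-long-path {u = u} {v = v} [] (y ∷ M₂) w uniq all _ =
  let _ , v→u = walk-split (u ∷ []) w ; _ , uniq₂ , disjoint = unique-++⁻ (u ∷ []) uniq
  in inj₂ (_ , v→u , unique-snoc uniq₂ (λ u∈ → disjoint (here refl , u∈)) , 3≤length v y M₂ u ,
           All.++⁺ (All.++⁻ʳ (u ∷ []) all) (All.head all ∷ []))
closed-long-path [] [] _ _ _ (s≤s ())

length-rotate : ∀ (us : List (Fin m)) z ws → length (us ++ z ∷ ws) ≡ suc (length (ws ++ us))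
length-rotate us z ws = begin
  length (us ++ z ∷ ws)        ≡⟨ length-++ us ⟩
  length us + suc (length ws)  ≡⟨ +-suc (length us) _ ⟩
  suc (length us + length ws)  ≡⟨ cong suc (+-comm (length us) _) ⟩
  suc (length ws + length us)  ≡⟨ cong suc (length-++ ws) ⟨
  suc (length (ws ++ us))      ∎
  where open ≡-Reasoning

cycle-long-path : ∀ {P u v} → Cycle A vs → All P vs → u ∈ vs → v ∈ vs → u ≢ v → 3 ≤ length vs →
                  LongPath A P u v ⊎ LongPath A P v u
cycle-long-path {A = A} {P = P} {u = u} {v = v} (x , y , w , yx , uniq , _) all u∈ v∈ u≢v long
  with ∈-∃++ u∈
... | us , ws , refl with ∈-∃++ v∈rest
  where
  v∈rest : v ∈ ws ++ us
  v∈rest with ∈-++⁻ us v∈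
  ... | inj₁ v∈us = ∈-++⁺ʳ ws v∈us
  ... | inj₂ (here v≡u) = contradiction (sym v≡u) u≢v
  ... | inj₂ (there v∈ws) = ∈-++⁺ˡ v∈ws
... | M₁ , M₂ , rest≡ =
  closed-long-path M₁ M₂
    (subst (λ L → IsWalk A u u (u ∷ L)) (trans (cong (_++ [ u ]) rest≡) (++-assoc M₁ (v ∷ M₂) [ u ])) (walk-rotate us w yx))
    (subst (λ L → Unique (u ∷ L)) rest≡ (unique-swap us uniq))
    (subst (λ L → All P (u ∷ L)) rest≡ (All.++⁺ (All.++⁻ʳ us all) (All.++⁻ˡ us all)))
    (subst (λ L → 2 ≤ length L) rest≡ (≤-pred (subst (3 ≤_) (length-rotate us u ws) long)))

arc-target∈tail : (a , b) ∈ arcsOf (z ∷ vs) → b ∈ vs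
arc-target∈tail {vs = _ ∷ _} (here refl) = here refl
arc-target∈tail {vs = _ ∷ _} (there ab∈) = there (arc-target∈tail ab∈)

path-avoids-ends : IsWalk A x y vs → Unique vs → 3 ≤ length vs → (a , b) ∈ arcsOf vs →
                   ¬ ((a ≡ x × b ≡ y) ⊎ (a ≡ y × b ≡ x))
path-avoids-ends (cons _ _) (x∉ ∷ _) _ ab∈ (inj₂ (_ , refl)) = All.lookup x∉ (arc-target∈tail ab∈) refl
path-avoids-ends (cons _ _) (x∉ ∷ _) _ (there ab∈) (inj₁ (refl , _)) =
  All.lookup x∉ (proj₁ (arcsOf-endpoints ab∈)) refl
path-avoids-ends (cons _ (cons _ w)) (_ ∷ z∉ ∷ _) _ (here refl) (inj₁ (_ , refl)) = All.lookup z∉ (walk-last w) refl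
path-avoids-ends (cons _ (single _)) _ (s≤s (s≤s ())) (here refl) (inj₁ _)

-- Deleting a digon

Digon : ∀ {m} → Fin m → Fin m → Fin m → Fin m → Set
Digon u v a b = (a ≡ u × b ≡ v) ⊎ (a ≡ v × b ≡ u)

not-digon : ∀ {m} {u v a b : Fin m} → a ≢ u ⊎ b ≢ v → a ≢ v ⊎ b ≢ u → ¬ Digon u v a b
not-digon (inj₁ a≢u) _ (inj₁ (a≡u , _)) = a≢u a≡u
not-digon (inj₂ b≢v) _ (inj₁ (_ , b≡v)) = b≢v b≡v
not-digon _ (inj₁ a≢v) (inj₂ (a≡v , _)) = a≢v a≡v
not-digon _ (inj₂ b≢u) (inj₂ (_ , b≡u)) = b≢u b≡u

module _ (D : Digraph) (u v : Vertex D) where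

  private
    D′ : Digraph
    D′ = removeDigon D u v

  removeDigon-arc : ∀ a b → (Digon u v a b × arc D′ a b ≡ false) ⊎ (¬ Digon u v a b × arc D′ a b ≡ arc D a b)
  removeDigon-arc a b with a ≟ u | b ≟ v | a ≟ v | b ≟ u
  ... | yes a≡u | yes b≡v | _       | _       = inj₁ (inj₁ (a≡u , b≡v) , refl)
  ... | yes _   | no _    | yes a≡v | yes b≡u = inj₁ (inj₂ (a≡v , b≡u) , refl)
  ... | no _    | _       | yes a≡v | yes b≡u = inj₁ (inj₂ (a≡v , b≡u) , refl)
  ... | yes _   | no b≢v  | no a≢v  | _       = inj₂ (not-digon (inj₂ b≢v) (inj₁ a≢v) , refl)
  ... | yes _   | no b≢v  | yes _   | no b≢u  = inj₂ (not-digon (inj₂ b≢v) (inj₂ b≢u) , refl)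
  ... | no a≢u  | _       | no a≢v  | _       = inj₂ (not-digon (inj₁ a≢u) (inj₁ a≢v) , refl)
  ... | no a≢u  | _       | yes _   | no b≢u  = inj₂ (not-digon (inj₁ a≢u) (inj₂ b≢u) , refl)

  removeDigon-⊆ : ∀ {a b} → arc D′ a b ≡ true → arc D a b ≡ true
  removeDigon-⊆ {a} {b} h with removeDigon-arc a b
  ... | inj₁ (_ , deleted) = contradiction deleted (true≢false h)
  ... | inj₂ (_ , same)    = trans (sym same) h

  removeDigon-keeps : ∀ {a b} → ¬ Digon u v a b → arc D a b ≡ true → arc D′ a b ≡ true
  removeDigon-keeps {a} {b} ¬digon ab with removeDigon-arc a b
  ... | inj₁ (digon , _) = contradiction digon ¬digon
  ... | inj₂ (_ , same)  = trans same ab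

  removeDigon-deletes : ∀ {a b} → Digon u v a b → arc D′ a b ≡ false
  removeDigon-deletes {a} {b} digon with removeDigon-arc a b
  ... | inj₁ (_ , deleted) = deleted
  ... | inj₂ (¬digon , _)  = contradiction digon ¬digon

  cycle-avoiding-digon : ∀ {vs} → (∀ {a b} → a ∈ vs → b ∈ vs → ¬ Digon u v a b) →
                         Cycle (arc D) vs → Cycle (arc D′) vs
  cycle-avoiding-digon avoids = cycle-map (λ a∈ b∈ → removeDigon-keeps (avoids a∈ b∈))

removeDigon-comm : (D : Digraph) (u v : Vertex D) {a b : Vertex D} →
                   arc (removeDigon D u v) a b ≡ arc (removeDigon D v u) a b
removeDigon-comm D u v {a} {b} with removeDigon-arc D u v a b | removeDigon-arc D v u a b
... | inj₁ (_ , deleted) | inj₁ (_ , deleted′) = trans deleted (sym deleted′)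
... | inj₂ (_ , same)    | inj₂ (_ , same′)    = trans same (sym same′)
... | inj₁ (digon , _)   | inj₂ (¬digon , _)   = contradiction (Sum.swap digon) ¬digon
... | inj₂ (¬digon , _)  | inj₁ (digon , _)   = contradiction (Sum.swap digon) ¬digon

no-monochromatic-path : ∀ {k} (D : Digraph) (u v : Vertex D) → arc D u v ≡ true →
                        ¬ Dicolourable D (suc k) → ¬ ArcDisjointPaths D u v (suc (suc k)) →
                        (c : Vertex D → Fin (suc k)) → IsDicolouring (removeDigon D u v) (suc k) c →
                        ¬ MonoPath (removeDigon D u v) c u v
no-monochromatic-path {k} D u v uv not-colourable few-paths c dicolours (P , (walk , _) , col , mono)
  with menger (arc D) u v (suc (suc k))
... | inj₁ paths = few-paths paths
... | inj₂ cut with walk-exit (SmallCut.X cut) walk (SmallCut.s∈X cut) (SmallCut.t∉X cut)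
...   | p , q , pq , Xp , Xq , p∈ , q∈ =
  not-colourable (glue-along-cut X c c (map colour-pair others) fewer covers′ (side true) (side false))
  where
  open SmallCut cut
  colour-pair : Vertex D × Vertex D → Fin (suc k) × Fin (suc k)
  colour-pair (a , b) = c a , c b
  other? : (e : Vertex D × Vertex D) → Dec (¬ e ≡ (u , v))
  other? e = ¬? (≡-dec _≟_ _≟_ e (u , v))
  others : List (Vertex D × Vertex D)
  others = filter other? cutArcs
  pq≢uv : (p , q) ≢ (u , v)
  pq≢uv refl = contradiction (removeDigon-deletes D u v (inj₁ (refl , refl))) (true≢false pq)
  fewer : length (map colour-pair others) < suc k
  fewer = subst (_< suc k) (sym (length-map colour-pair others))
            (<-≤-trans (filter-notAll other? cutArcs (Any.map (λ { refl ne → ne refl }) (covers uv s∈X t∉X)))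
                       (≤-pred small))
  -- The deleted arc uv needs no pair of its own: P leaves X through an arc with the same colours.
  covers′ : ∀ {a b} → arc D a b ≡ true → X a ≡ true → X b ≡ false → (c a , c b) ∈ map colour-pair others
  covers′ {a} {b} ab Xa Xb with ≡-dec _≟_ _≟_ (a , b) (u , v)
  ... | no ab≢uv = ∈-map⁺ colour-pair (∈-filter⁺ other? (covers ab Xa Xb) ab≢uv)
  ... | yes refl = subst (_∈ map colour-pair others) (cong₂ _,_ (same p∈ (walk-head walk)) (same q∈ (walk-last walk)))
                         (∈-map⁺ colour-pair (∈-filter⁺ other? (covers (removeDigon-⊆ D u v pq) Xp Xq) pq≢uv))
    where
    same : ∀ {z z′} → z ∈ P → z′ ∈ P → c z ≡ c z′
    same z∈ z′∈ = trans (All.lookup mono z∈) (sym (All.lookup mono z′∈))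
  same-side : ∀ {β a b} → X a ≡ β → X b ≡ β → ¬ Digon u v a b
  same-side Xa Xb (inj₁ (refl , refl)) = true≢false s∈X (trans (trans Xa (sym Xb)) t∉X)
  same-side Xa Xb (inj₂ (refl , refl)) = true≢false s∈X (trans (trans Xb (sym Xa)) t∉X)
  side : ∀ β vs → Cycle (arc D) vs → All (λ z → X z ≡ β) vs → ¬ Monochromatic c vs
  side β vs cyc all-β =
    dicolours vs (cycle-avoiding-digon D u v (λ a∈ b∈ → same-side (All.lookup all-β a∈) (All.lookup all-β b∈)) cyc)

-- Extremal digraphs

module ExtremalDigon {k} (D : Digraph) (extremal : Extremal (suc k) D) (u v : Vertex D)
                         (uv : arc D u v ≡ true) (vu : arc D v u ≡ true) where

  D′ : Digraph
  D′ = removeDigon D u v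

  biconnected : Biconnected D
  biconnected = proj₁ extremal

  strong : Strong D
  strong = proj₁ (proj₂ extremal)

  not-colourable : ¬ Dicolourable D (suc k)
  not-colourable colouring = n≮n (suc k) (proj₂ (proj₁ (proj₂ (proj₂ extremal))) (suc k) colouring)

  few-paths : ∀ x y → x ≢ y → ¬ ArcDisjointPaths D x y (suc (suc k))
  few-paths x y x≢y paths = n≮n (suc k) (proj₂ (proj₂ (proj₂ (proj₂ extremal))) x y (suc (suc k)) x≢y paths)

  u≢v : u ≢ v
  u≢v refl = true≢false uv (loopless D u)

  no-uv-path : ∀ c → IsDicolouring D′ (suc k) c → ¬ MonoPath D′ c u v
  no-uv-path = no-monochromatic-path D u v uv not-colourable (few-paths u v u≢v)

  no-vu-path : ∀ c → IsDicolouring D′ (suc k) c → ¬ MonoPath D′ c v u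
  no-vu-path c dicolours (p , (walk , uniq) , mono) =
    no-monochromatic-path D v u vu not-colourable (few-paths v u (u≢v ∘ sym)) c
      (λ vs cyc → dicolours vs (cycle-map (λ _ _ → trans (removeDigon-comm D u v)) cyc))
      (p , (walk-map (trans (sym (removeDigon-comm D u v))) walk , uniq) , mono)

  Detour : (Vertex D → Bool) → Set
  Detour S = ∃₂ λ x y → S x ≡ true × S y ≡ true × x ≢ y ×
             ∃ λ p → IsWalk (arc D) x y p × Unique p × (∀ {a b} → (a , b) ∈ arcsOf p → induced (arc D′) S a b ≡ false)

  ear⇒detour : ∀ S → Ear D S → Detour S
  ear⇒detour S (x , y , Sx , Sy , x≢y , _ , outer-walk) =
    let p , walk , uniq = walk⇒path outer-walk
    in x , y , Sx , Sy , x≢y , p , walk-map (outer⊆arc D S) walk , uniq ,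
       λ ab∈ → outer-not-induced D S {B = arc D′} (walk-arc walk ab∈)

  detour : ∀ S {x₀ y₀} → S x₀ ≡ true → S y₀ ≡ true → x₀ ≢ y₀ → Detour S
  detour S Sx₀ Sy₀ x₀≢y₀ with S u in Su | S v in Sv
  ... | true  | true  = u , v , Su , Sv , u≢v , u ∷ v ∷ [] , cons uv (single v) , (u≢v ∷ []) ∷ [] ∷ [] , digon-arc
    where
    digon-arc : ∀ {a b} → (a , b) ∈ arcsOf (u ∷ v ∷ []) → induced (arc D′) S a b ≡ false
    digon-arc (here refl) rewrite removeDigon-deletes D u v (inj₁ (refl , refl)) = refl
  ... | false | _     = ear⇒detour S (ear D S strong biconnected Sx₀ Sy₀ x₀≢y₀ Su)
  ... | true  | false = ear⇒detour S (ear D S strong biconnected Sx₀ Sy₀ x₀≢y₀ Sv)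

  sparse : ∀ S {x₀ y₀} → S x₀ ≡ true → S y₀ ≡ true → x₀ ≢ y₀ →
           ∃₂ λ x y → S x ≡ true × S y ≡ true × ¬ DisjointPaths (induced (arc D′) S) x y (suc k)
  sparse S Sx₀ Sy₀ x₀≢y₀ =
    let x , y , Sx , Sy , x≢y , _ , walk , uniq , outside = detour S Sx₀ Sy₀ x₀≢y₀
    in x , y , Sx , Sy ,
       λ paths → few-paths x y x≢y (disjointPaths-cons induced⊆D walk uniq outside paths)
    where
    induced⊆D : induced (arc D′) S ⊆ᴬ arc D
    induced⊆D _ _ h = removeDigon-⊆ D u v (induced-⊆ {A = arc D′} {S = S} h)

  colouring : ∃ λ (c : Vertex D → Fin (suc k)) → IsDicolouring D′ (suc k) c
  colouring = dicolouring-from-sparse-pairs (arc D′) sparse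

  c₀ : Vertex D → Fin (suc k)
  c₀ = proj₁ colouring

  dicolours₀ : IsDicolouring D′ (suc k) c₀
  dicolours₀ = proj₂ colouring

  mono-cycle-uses-digon : ∀ {vs col} → Cycle (arc D) vs → All (λ z → c₀ z ≡ col) vs →
                          ¬ (∀ {a b} → a ∈ vs → b ∈ vs → ¬ Digon u v a b)
  mono-cycle-uses-digon cyc mono avoids = dicolours₀ _ (cycle-avoiding-digon D u v avoids cyc) (_ , mono)

  digon-monochromatic : c₀ u ≡ c₀ v
  digon-monochromatic with c₀ u ≟ c₀ v
  ... | yes same = same
  ... | no differ = contradiction (c₀ , λ vs cyc (col , mono) → mono-cycle-uses-digon cyc mono (avoids mono)) not-colourable
    where
    avoids : ∀ {col vs a b} → All (λ z → c₀ z ≡ col) vs → a ∈ vs → b ∈ vs → ¬ Digon u v a b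
    avoids mono a∈ b∈ (inj₁ (refl , refl)) = differ (trans (All.lookup mono a∈) (sym (All.lookup mono b∈)))
    avoids mono a∈ b∈ (inj₂ (refl , refl)) = differ (trans (All.lookup mono b∈) (sym (All.lookup mono a∈)))

  no-long-mono-cycle : ∀ {vs col} → Cycle (arc D) vs → All (λ z → c₀ z ≡ col) vs →
                       u ∈ vs → v ∈ vs → ¬ 3 ≤ length vs
  no-long-mono-cycle {col = col} cyc mono u∈ v∈ long with cycle-long-path cyc mono u∈ v∈ u≢v long
  ... | inj₁ (p , walk , uniq , long-p , mono-p) = no-uv-path c₀ dicolours₀
    (p , (walk-mapᵃ (λ ab∈ → removeDigon-keeps D u v (path-avoids-ends walk uniq long-p ab∈)) walk , uniq) , col , mono-p)
  ... | inj₂ (p , walk , uniq , long-p , mono-p) = no-vu-path c₀ dicolours₀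
    (p , (walk-mapᵃ (λ ab∈ → removeDigon-keeps D u v (path-avoids-ends walk uniq long-p ab∈ ∘ Sum.swap)) walk , uniq) , col , mono-p)

  only-digon : (vs : List (Vertex D)) → IsCycle D vs → Monochromatic c₀ vs →
               (vs ≡ u ∷ v ∷ []) ⊎ (vs ≡ v ∷ u ∷ [])
  only-digon vs cyc (_ , mono) with Any.any? (u ≟_) vs | Any.any? (v ≟_) vs
  ... | no u∉ | _ = ⊥-elim (mono-cycle-uses-digon cyc mono avoids)
    where
    avoids : ∀ {a b} → a ∈ vs → b ∈ vs → ¬ Digon u v a b
    avoids a∈ _ (inj₁ (refl , _)) = u∉ a∈
    avoids _ b∈ (inj₂ (_ , refl)) = u∉ b∈
  ... | yes _ | no v∉ = ⊥-elim (mono-cycle-uses-digon cyc mono avoids)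
    where
    avoids : ∀ {a b} → a ∈ vs → b ∈ vs → ¬ Digon u v a b
    avoids _ b∈ (inj₁ (_ , refl)) = v∉ b∈
    avoids a∈ _ (inj₂ (refl , _)) = v∉ a∈
  ... | yes u∈ | yes v∈ = pair vs cyc u∈ v∈ (no-long-mono-cycle cyc mono u∈ v∈)
    where
    pair : ∀ vs → IsCycle D vs → u ∈ vs → v ∈ vs → ¬ 3 ≤ length vs → (vs ≡ u ∷ v ∷ []) ⊎ (vs ≡ v ∷ u ∷ [])
    pair (_ ∷ []) (_ , _ , _ , _ , _ , s≤s ()) _ _ _
    pair (_ ∷ _ ∷ []) _ (here refl) (there (here refl)) _ = inj₁ refl
    pair (_ ∷ _ ∷ []) _ (there (here refl)) (here refl) _ = inj₂ refl
    pair (_ ∷ _ ∷ []) _ (here refl) (here refl) _ = contradiction refl u≢v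
    pair (_ ∷ _ ∷ []) _ (there (here refl)) (there (here refl)) _ = contradiction refl u≢v
    pair (_ ∷ _ ∷ _ ∷ _) _ _ _ short = contradiction (s≤s (s≤s (s≤s z≤n))) short

lemma4p3 : (k : ℕ) → 1 ≤ k → (D : Digraph) → Extremal k D →
    (u v : Vertex D) → arc D u v ≡ true → arc D v u ≡ true →
    ((c : Vertex D → Fin k) → IsDicolouring (removeDigon D u v) k c →
       ¬ MonoPath (removeDigon D u v) c u v × ¬ MonoPath (removeDigon D u v) c v u)
    × Σ (Vertex D → Fin k) (λ c →
        Monochromatic c (u ∷ v ∷ [])
        × ((vs : List (Vertex D)) → IsCycle D vs → Monochromatic c vs →
             (vs ≡ u ∷ v ∷ []) ⊎ (vs ≡ v ∷ u ∷ [])))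
lemma4p3 (suc k) (s≤s z≤n) D extremal u v uv vu =
  (λ c dicolours → no-uv-path c dicolours , no-vu-path c dicolours) ,
  c₀ , (c₀ u , refl ∷ sym digon-monochromatic ∷ []) , only-digon
  where open ExtremalDigon D extremal u v uv vu
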